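{- Let $X$ be an $n$-element set and let $\pi_X\in\Pi_l(X)$ be a labelled set partition into singletons of which exactly $k$ are labelled. Then the matrix $\mathbf{M}$ is invertible if and only if $P(n,k)=P_0(n,k)$, and in this case $\mathbf{M}=\mathbf{M}_0$.
   Context: For a finite set $X$ and a symbol $l\notin X$, a labelled set partition of $X$ is $\pi=\{B_1\cup L_1,\dots,B_k\cup L_k\}$ with $\{B_1,\dots,B_k\}$ a set partition of $X$ and $L_i\in\{\emptyset,\{l\}\}$ (labelled block iff $L_i=\{l\}$). $\Pi_l(X)$ is the set of these, ordered by $\sigma\le\pi$ iff every block of $\sigma$ (including $l$ if present) is contained in a block of $\pi$; it is a lattice with join $\vee$; $\mu$ is its Möbius function. $m(\pi)=1$ if $\pi$ has exactly one labelled block, else $0$. $\Pi_l(X,\pi_X)=\{\pi\in\Pi_l(X):\pi\ge\pi_X,\ \pi\text{ has at least one labelled block}\}$ and $P(n,k)=|\Pi_l(X,\pi_X)|$. For $\pi\in\Pi_l(X,\pi_X)$, $\lambda(\pi)=\sum_{\sigma\in\Pi_l(X,\pi_X),\sigma\ge\pi}\mu(\pi,\sigma)m(\sigma)$; $\Pi_l(X,\pi_X)_0=\{\pi\in\Pi_l(X,\pi_X):\lambda(\pi)\ne0\}$ and $P_0(n,k)=|\Pi_l(X,\pi_X)_0|$. $\mathbf{M}=(m(\pi\vee\sigma))_{\pi,\sigma\in\Pi_l(X,\pi_X)}$ and $\mathbf{M}_0$ is its principal submatrix indexed by $\Pi_l(X,\pi_X)_0$. -}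

module Defs where

open import Data.Bool using (Bool; true; false; _∧_; _∨_; not; if_then_else_)
open import Data.Nat using (ℕ; zero; suc; _≤ᵇ_; _≡ᵇ_)
open import Data.Fin as Fin using (Fin; toℕ)
open import Data.Vec as Vec using (Vec; []; _∷_)
open import Data.List as List using (List; []; _∷_; length; filterᵇ; allFin; concatMap)
open import Data.Integer as ℤ using (ℤ)
open import Data.Rational as ℚ using (ℚ)
open import Data.Product using (Σ; _×_)
open import Relation.Binary.PropositionalEquality using (_≡_)
open import Relation.Nullary.Decidable using (⌊_⌋)
import Data.Bool.Properties as BoolP
open import Data.Bool.ListAction using () renaming (all to allL; any to anyL)

-- A labelled set partition is encoded canonically by
--   rep : each element i ↦ the least element of its block,
--   lab : each element i ↦ whether its block is labelled (contains l).  Valid pairs are in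
-- bijection with labelled set partitions {B₁ ∪ L₁, …, B_k ∪ L_k}.

record LPart (n : ℕ) : Set where
  constructor lpart
  field
    rep : Vec (Fin n) n
    lab : Vec Bool n
open LPart public

infix 4 _==F_ _==B_
_==F_ : ∀ {n} → Fin n → Fin n → Bool
x ==F y = ⌊ x Fin.≟ y ⌋

_==B_ : Bool → Bool → Bool
x ==B y = ⌊ x BoolP.≟ y ⌋

forallFin : ∀ n → (Fin n → Bool) → Bool
forallFin n p = allL p (allFin n)

existsFin : ∀ n → (Fin n → Bool) → Bool
existsFin n p = anyL p (allFin n)

rp : ∀ {n} → LPart n → Fin n → Fin n
rp π i = Vec.lookup (rep π) i

lb : ∀ {n} → LPart n → Fin n → Bool
lb π i = Vec.lookup (lab π) i

valid : ∀ {n} → LPart n → Bool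
valid {n} π = forallFin n λ i →
  (toℕ (rp π i) ≤ᵇ toℕ i) ∧ (rp π (rp π i) ==F rp π i) ∧ (lb π i ==B lb π (rp π i))

allVecs : ∀ {A : Set} → List A → (n : ℕ) → List (Vec A n)
allVecs xs zero    = [] ∷ []
allVecs xs (suc n) = concatMap (λ x → List.map (x ∷_) (allVecs xs n)) xs

Πl : (n : ℕ) → List (LPart n)
Πl n = filterᵇ valid
  (concatMap (λ r → List.map (lpart r) (allVecs (true ∷ false ∷ []) n))
             (allVecs (allFin n) n))

eqLP : ∀ {n} → LPart n → LPart n → Bool
eqLP {n} σ π = forallFin n λ i → (rp σ i ==F rp π i) ∧ (lb σ i ==B lb π i)

-- σ ≤ π : every block of σ lies in a block of π, labelled blocks in labelled blocks
leq : ∀ {n} → LPart n → LPart n → Bool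
leq {n} σ π = forallFin n λ i →
  (rp π i ==F rp π (rp σ i)) ∧ (not (lb σ i) ∨ lb π i)

lt : ∀ {n} → LPart n → LPart n → Bool
lt σ π = leq σ π ∧ not (eqLP σ π)

firstWith : ∀ {A : Set} → (A → Bool) → List A → A → A
firstWith p []       d = d
firstWith p (x ∷ xs) d = if p x then x else firstWith p xs d

-- join σ ∨ π in the lattice Π_l(X): the least upper bound
-- (it exists since Π_l(X) is a lattice; the default is never used)
_∨L_ : ∀ {n} → LPart n → LPart n → LPart n
_∨L_ {n} σ π = firstWith isLub (Πl n) π
  where
  ub : LPart n → Bool
  ub z = leq σ z ∧ leq π z
  isLub : LPart n → Bool
  isLub z = ub z ∧ allL (λ w → not (ub w) ∨ leq z w) (Πl n)

-- Möbius function of Π_l(X):  μ(x,x) = 1,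
-- μ(x,y) = - Σ_{x ≤ z < y} μ(x,z) for x < y, μ(x,y) = 0 otherwise.
-- Defined with fuel; fuel |Π_l(X)| exceeds every chain length, so it is exact.
sumℤ : List ℤ → ℤ
sumℤ = List.foldr ℤ._+_ (ℤ.+ 0)

μF : ∀ {n} → ℕ → LPart n → LPart n → ℤ
μF zero    x y = ℤ.+ 0
μF {n} (suc f) x y =
  if eqLP x y then ℤ.+ 1
  else if leq x y
       then ℤ.- sumℤ (List.map (μF f x) (filterᵇ (λ z → leq x z ∧ lt z y) (Πl n)))
       else ℤ.+ 0

μ : ∀ {n} → LPart n → LPart n → ℤ
μ {n} x y = μF (length (Πl n)) x y

numLabelled : ∀ {n} → LPart n → ℕ
numLabelled {n} π = List.length (filterᵇ (λ i → (rp π i ==F i) ∧ lb π i) (allFin n))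

m : ∀ {n} → LPart n → ℕ
m π = if numLabelled π ≡ᵇ 1 then 1 else 0

hasLabelled : ∀ {n} → LPart n → Bool
hasLabelled {n} π = existsFin n (lb π)

singletonLP : ∀ {n} → Vec Bool n → LPart n
singletonLP {n} ℓ = lpart (Vec.tabulate (λ i → i)) ℓ

numTrue : ∀ {n} → Vec Bool n → ℕ
numTrue []          = 0
numTrue (true ∷ v)  = suc (numTrue v)
numTrue (false ∷ v) = numTrue v

ΠlX : ∀ {n} → LPart n → List (LPart n)
ΠlX {n} πX = filterᵇ (λ π → leq πX π ∧ hasLabelled π) (Πl n)

λF : ∀ {n} → LPart n → LPart n → ℤ
λF πX π = sumℤ (List.map (λ σ → μ π σ ℤ.* ℤ.+ (m σ)) (filterᵇ (leq π) (ΠlX πX)))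

ΠlX0 : ∀ {n} → LPart n → List (LPart n)
ΠlX0 πX = filterᵇ (λ π → not ⌊ λF πX π ℤ.≟ ℤ.+ 0 ⌋) (ΠlX πX)

P : ∀ {n} → LPart n → ℕ
P πX = length (ΠlX πX)

P0 : ∀ {n} → LPart n → ℕ
P0 πX = length (ΠlX0 πX)

Matrix : ℕ → Set
Matrix p = Fin p → Fin p → ℚ

mMatrix : ∀ {n} (L : List (LPart n)) → Matrix (length L)
mMatrix L i j = ℤ.+ (m (List.lookup L i ∨L List.lookup L j)) ℚ./ 1

M : ∀ {n} (πX : LPart n) → Matrix (P πX)
M πX = mMatrix (ΠlX πX)

M0 : ∀ {n} (πX : LPart n) → Matrix (P0 πX)
M0 πX = mMatrix (ΠlX0 πX)

sumFin : ∀ p → (Fin p → ℚ) → ℚ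
sumFin zero    f = ℚ.0ℚ
sumFin (suc p) f = f Fin.zero ℚ.+ sumFin p (λ i → f (Fin.suc i))

_·_ : ∀ {p} → Matrix p → Matrix p → Matrix p
_·_ {p} A B i j = sumFin p (λ k → A i k ℚ.* B k j)

I : ∀ {p} → Matrix p
I i j = if i ==F j then ℚ.1ℚ else ℚ.0ℚ

Invertible : ∀ {p} → Matrix p → Set
Invertible A = Σ (Matrix _) λ B → (∀ i j → (A · B) i j ≡ I i j) × (∀ i j → (B · A) i j ≡ I i j)

module Submission where

-- The proof is an instance of a Lindström-type theorem on join matrices.
-- In a finite poset with Möbius function μ, let U be an up-set closed
-- under joins and f a function on U with Möbius transform
--   λ(τ) = Σ_{σ ∈ U} μ(τ,σ) f(σ).
-- Möbius inversion gives f(ρ) = Σ_{τ ∈ U, τ ≥ ρ} λ(τ), hence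
--   f(ρ ∨ ρ') = Σ_{τ ∈ U} [ρ ≤ τ] [ρ' ≤ τ] λ(τ),
-- i.e. the join matrix (f(ρ ∨ σ)) is Z diag(λ) Zᵀ with Z = ([ρ ≤ τ])
-- unitriangular (its inverse is given by μ).  So the join matrix is
-- invertible over ℚ iff λ vanishes nowhere on U.
--
-- The argument works for every labelled partition π_X, in particular for
-- the partition into singletons of Corollary 6.9.

open import Algebra.Bundles using (CommutativeRing)
import Algebra.Properties.Semiring.Sum as SemiringSum
open import Data.Bool using (Bool; true; false; _∧_; _∨_; not; if_then_else_; T)
open import Data.Bool.Properties using (∧-zeroʳ; ∧-identityʳ; ∧-comm)
open import Data.Bool.ListAction using () renaming (all to allL; any to anyL)
open import Data.Empty using (⊥-elim)
open import Data.Fin as Fin using (Fin; toℕ; cast)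
import Data.Fin.Properties as FinP
open import Data.Integer as ℤ using (ℤ)
import Data.Integer.Properties as ℤP
open import Data.List as List using (List; []; _∷_; length; filterᵇ; allFin; concatMap; map; foldr; _++_)
import Data.List.Properties as ListP
open import Data.List.Membership.Propositional using (_∈_; _∉_)
open import Data.List.Membership.Propositional.Properties
  using (∈-map⁺; ∈-map⁻; ∈-++⁺ˡ; ∈-++⁺ʳ; ∈-++⁻; ∈-allFin; ∈-lookup)
import Data.List.Relation.Unary.All as All
import Data.List.Relation.Unary.AllPairs as AllPairs
import Data.List.Relation.Unary.Any as Any
open import Data.List.Relation.Unary.Any using (here; there)
open import Data.List.Relation.Unary.Any.Properties using (lookup-index)
open import Data.List.Relation.Unary.Unique.Propositional using (Unique)
import Data.List.Relation.Unary.Unique.Propositional.Properties as UniqueP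
open import Data.Maybe as Maybe using (Maybe; just; nothing; fromMaybe)
open import Data.Nat as ℕ using (ℕ; zero; suc; _≤_; _<_; z≤n; s≤s)
import Data.Nat.Properties as ℕP
open import Data.Product using (Σ; _×_; _,_; proj₁; proj₂)
open import Data.Rational as ℚ using (ℚ)
import Data.Rational.Properties as ℚP
open import Data.Rational.Unnormalised as ℚᵘ using (mkℚᵘ; *≡*)
import Data.Rational.Unnormalised.Properties as ℚᵘP
open import Data.Sum using (inj₁; inj₂; [_,_]′)
open import Data.Vec as Vec using (Vec; []; _∷_)
import Data.Vec.Properties as VecP
open import Function using (_∘_)
open import Function.Bundles using (_⇔_; mk⇔; Equivalence)
open import Function.Construct.Composition using (_⇔-∘_)
open import Function.Construct.Symmetry using (⇔-sym)
open import Level using (0ℓ)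
open import Relation.Binary.PropositionalEquality
open import Relation.Nullary using (yes; no)
open import Relation.Nullary.Decidable using (T?; ⌊_⌋)

-- The generic Möbius function below is also called μ; Labelled.μF≡μ-fuel
-- identifies it with the one of Defs.
open import Defs hiding (μ)

true≢false : true ≢ false
true≢false ()

∧-true₁ : ∀ {a b} → a ∧ b ≡ true → a ≡ true
∧-true₁ {true} _ = refl

∧-true₂ : ∀ {a b} → a ∧ b ≡ true → b ≡ true
∧-true₂ {true} e = e

∧-intro : ∀ {a b} → a ≡ true → b ≡ true → a ∧ b ≡ true
∧-intro refl refl = refl

⇒-elim : ∀ {a b} → not a ∨ b ≡ true → a ≡ true → b ≡ true
⇒-elim {true} e refl = e

⇒-intro : ∀ {a b} → (a ≡ true → b ≡ true) → not a ∨ b ≡ true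
⇒-intro {true} h = h refl
⇒-intro {false} h = refl

bool-ext : ∀ {a b} → (a ≡ true → b ≡ true) → (b ≡ true → a ≡ true) → a ≡ b
bool-ext {true} f g = sym (f refl)
bool-ext {false} {true} f g = g refl
bool-ext {false} {false} f g = refl

allL-elim : {A : Set} (p : A → Bool) (xs : List A) → allL p xs ≡ true → ∀ x → x ∈ xs → p x ≡ true
allL-elim p (y ∷ xs) e x (here refl) = ∧-true₁ e
allL-elim p (y ∷ xs) e x (there m) = allL-elim p xs (∧-true₂ {p y} e) x m

allL-intro : {A : Set} (p : A → Bool) (xs : List A) → (∀ x → x ∈ xs → p x ≡ true) → allL p xs ≡ true
allL-intro p [] h = refl
allL-intro p (y ∷ xs) h = ∧-intro (h y (here refl)) (allL-intro p xs (λ x m → h x (there m)))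

anyL-elim : {A : Set} (p : A → Bool) (xs : List A) → anyL p xs ≡ true → Σ A λ x → x ∈ xs × p x ≡ true
anyL-elim p (y ∷ xs) e with p y in py
... | true = y , here refl , py
... | false = let (x , x∈ , px) = anyL-elim p xs e in x , there x∈ , px

anyL-intro : {A : Set} (p : A → Bool) (xs : List A) → ∀ x → x ∈ xs → p x ≡ true → anyL p xs ≡ true
anyL-intro p (y ∷ xs) x (here refl) px rewrite px = refl
anyL-intro p (y ∷ xs) x (there m) px with p y
... | true = refl
... | false = anyL-intro p xs x m px

forallFin-elim : ∀ {n} (p : Fin n → Bool) → forallFin n p ≡ true → ∀ i → p i ≡ true
forallFin-elim {n} p e i = allL-elim p (allFin n) e i (∈-allFin i)

forallFin-intro : ∀ {n} (p : Fin n → Bool) → (∀ i → p i ≡ true) → forallFin n p ≡ true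
forallFin-intro {n} p h = allL-intro p (allFin n) (λ x _ → h x)

==F-sound : ∀ {n} {x y : Fin n} → (x ==F y) ≡ true → x ≡ y
==F-sound {x = x} {y} e with x Fin.≟ y
... | yes x≡y = x≡y

==F-complete : ∀ {n} {x y : Fin n} → x ≡ y → (x ==F y) ≡ true
==F-complete {x = x} {y} x≡y with x Fin.≟ y
... | yes _ = refl
... | no x≢y = ⊥-elim (x≢y x≡y)

==B-sound : ∀ {x y : Bool} → (x ==B y) ≡ true → x ≡ y
==B-sound {true} {true} _ = refl
==B-sound {false} {false} _ = refl

==B-complete : ∀ {x y : Bool} → x ≡ y → (x ==B y) ≡ true
==B-complete {true} refl = refl
==B-complete {false} refl = refl

boolEq-sym : {A : Set} (E : A → A → Bool) → (∀ x y → E x y ≡ true → x ≡ y) → (∀ x → E x x ≡ true) →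
  ∀ x y → E x y ≡ E y x
boolEq-sym E sound refl' x y = bool-ext (λ e → subst (λ z → E z x ≡ true) (sound x y e) (refl' x))
                                        (λ e → subst (λ z → E z y ≡ true) (sound y x e) (refl' y))

-- Duplicate-free lists.  Sums over such lists behave like sums over
-- finite sets; in particular a Kronecker delta picks out one summand.

data Nodup {A : Set} : List A → Set where
  []  : Nodup []
  _∷_ : ∀ {x xs} → x ∉ xs → Nodup xs → Nodup (x ∷ xs)

filter-∈⁻ : {A : Set} (p : A → Bool) (xs : List A) → ∀ {z} → z ∈ filterᵇ p xs → z ∈ xs × p z ≡ true
filter-∈⁻ p (x ∷ xs) z∈ with p x in px
filter-∈⁻ p (x ∷ xs) (here refl) | true = here refl , px
filter-∈⁻ p (x ∷ xs) (there z∈) | true = let (z∈xs , pz) = filter-∈⁻ p xs z∈ in there z∈xs , pz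
... | false = let (z∈xs , pz) = filter-∈⁻ p xs z∈ in there z∈xs , pz

filter-∈⁺ : {A : Set} (p : A → Bool) (xs : List A) → ∀ {z} → z ∈ xs → p z ≡ true → z ∈ filterᵇ p xs
filter-∈⁺ p (x ∷ xs) (here refl) pz rewrite pz = here refl
filter-∈⁺ p (x ∷ xs) (there z∈) pz with p x
... | true = there (filter-∈⁺ p xs z∈ pz)
... | false = filter-∈⁺ p xs z∈ pz

filter-nodup : {A : Set} (p : A → Bool) (xs : List A) → Nodup xs → Nodup (filterᵇ p xs)
filter-nodup p [] nd = []
filter-nodup p (x ∷ xs) (x∉ ∷ nd) with p x
... | true = (λ x∈ → x∉ (proj₁ (filter-∈⁻ p xs x∈))) ∷ filter-nodup p xs nd
... | false = filter-nodup p xs nd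

module ListSum (R : CommutativeRing 0ℓ 0ℓ)
  (≈⇒≡ : ∀ {x y} → CommutativeRing._≈_ R x y → x ≡ y) where

  open CommutativeRing R using (Carrier; _+_; _*_; -_; 0#; 1#)
  private module R = CommutativeRing R
  open ≡-Reasoning

  +-assoc : ∀ x y z → (x + y) + z ≡ x + (y + z)
  +-assoc x y z = ≈⇒≡ (R.+-assoc x y z)
  +-comm : ∀ x y → x + y ≡ y + x
  +-comm x y = ≈⇒≡ (R.+-comm x y)
  +-identityˡ : ∀ x → 0# + x ≡ x
  +-identityˡ x = ≈⇒≡ (R.+-identityˡ x)
  +-identityʳ : ∀ x → x + 0# ≡ x
  +-identityʳ x = ≈⇒≡ (R.+-identityʳ x)
  -‿inverseˡ : ∀ x → (- x) + x ≡ 0#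
  -‿inverseˡ x = ≈⇒≡ (R.-‿inverseˡ x)
  *-comm : ∀ x y → x * y ≡ y * x
  *-comm x y = ≈⇒≡ (R.*-comm x y)
  *-assoc : ∀ x y z → (x * y) * z ≡ x * (y * z)
  *-assoc x y z = ≈⇒≡ (R.*-assoc x y z)
  *-identityˡ : ∀ x → 1# * x ≡ x
  *-identityˡ x = ≈⇒≡ (R.*-identityˡ x)
  *-identityʳ : ∀ x → x * 1# ≡ x
  *-identityʳ x = ≈⇒≡ (R.*-identityʳ x)
  zeroˡ : ∀ x → 0# * x ≡ 0#
  zeroˡ x = ≈⇒≡ (R.zeroˡ x)
  zeroʳ : ∀ x → x * 0# ≡ 0#
  zeroʳ x = ≈⇒≡ (R.zeroʳ x)
  distribˡ : ∀ x y z → x * (y + z) ≡ x * y + x * z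
  distribˡ x y z = ≈⇒≡ (R.distribˡ x y z)

  ∑ : {B : Set} → List B → (B → Carrier) → Carrier
  ∑ L f = foldr _+_ 0# (map f L)

  syntax ∑ L (λ x → e) = ∑[ x ∈ L ] e

  ind : Bool → Carrier
  ind true = 1#
  ind false = 0#

  ind-∧ : ∀ a b → ind (a ∧ b) ≡ ind a * ind b
  ind-∧ true b = sym (*-identityˡ (ind b))
  ind-∧ false b = sym (zeroˡ (ind b))

  ∑-cong : {B : Set} (L : List B) {f g : B → Carrier} → (∀ z → z ∈ L → f z ≡ g z) → ∑ L f ≡ ∑ L g
  ∑-cong [] h = refl
  ∑-cong (x ∷ L) h = cong₂ _+_ (h x (here refl)) (∑-cong L (λ z z∈ → h z (there z∈)))

  ∑-zero : {B : Set} (L : List B) {f : B → Carrier} → (∀ z → z ∈ L → f z ≡ 0#) → ∑ L f ≡ 0#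
  ∑-zero [] h = refl
  ∑-zero (x ∷ L) h = trans (cong₂ _+_ (h x (here refl)) (∑-zero L (λ z z∈ → h z (there z∈)))) (+-identityˡ 0#)

  ∑-+ : {B : Set} (L : List B) (f g : B → Carrier) → ∑[ z ∈ L ] (f z + g z) ≡ ∑ L f + ∑ L g
  ∑-+ [] f g = sym (+-identityˡ 0#)
  ∑-+ (x ∷ L) f g = begin
    (f x + g x) + ∑[ z ∈ L ] (f z + g z) ≡⟨ cong ((f x + g x) +_) (∑-+ L f g) ⟩
    (f x + g x) + (∑ L f + ∑ L g)      ≡⟨ +-assoc (f x) (g x) _ ⟩
    f x + (g x + (∑ L f + ∑ L g))      ≡⟨ cong (f x +_) (sym (+-assoc (g x) (∑ L f) (∑ L g))) ⟩
    f x + ((g x + ∑ L f) + ∑ L g)      ≡⟨ cong (λ t → f x + (t + ∑ L g)) (+-comm (g x) (∑ L f)) ⟩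
    f x + ((∑ L f + g x) + ∑ L g)      ≡⟨ cong (f x +_) (+-assoc (∑ L f) (g x) (∑ L g)) ⟩
    f x + (∑ L f + (g x + ∑ L g))      ≡⟨ sym (+-assoc (f x) (∑ L f) _) ⟩
    (f x + ∑ L f) + (g x + ∑ L g)      ∎

  ∑-*ˡ : {B : Set} (L : List B) (c : Carrier) (f : B → Carrier) → c * ∑ L f ≡ ∑[ z ∈ L ] (c * f z)
  ∑-*ˡ [] c f = zeroʳ c
  ∑-*ˡ (x ∷ L) c f = trans (distribˡ c (f x) (∑ L f)) (cong ((c * f x) +_) (∑-*ˡ L c f))

  ∑-*ʳ : {B : Set} (L : List B) (c : Carrier) (f : B → Carrier) → ∑ L f * c ≡ ∑[ z ∈ L ] (f z * c)
  ∑-*ʳ L c f = trans (*-comm (∑ L f) c) (trans (∑-*ˡ L c f) (∑-cong L (λ z _ → *-comm c (f z))))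

  ∑-comm : {B C : Set} (K : List B) (L : List C) (f : B → C → Carrier) →
    ∑[ a ∈ K ] ∑[ b ∈ L ] f a b ≡ ∑[ b ∈ L ] ∑[ a ∈ K ] f a b
  ∑-comm [] L f = sym (∑-zero L (λ _ _ → refl))
  ∑-comm (x ∷ K) L f = trans (cong (∑ L (f x) +_) (∑-comm K L f))
    (sym (∑-+ L (f x) (λ b → ∑[ a ∈ K ] f a b)))

  ∑-filter : {B : Set} (p : B → Bool) (L : List B) (f : B → Carrier) →
    ∑ (filterᵇ p L) f ≡ ∑[ z ∈ L ] (ind (p z) * f z)
  ∑-filter p [] f = refl
  ∑-filter p (x ∷ L) f with p x
  ... | true = cong₂ _+_ (sym (*-identityˡ (f x))) (∑-filter p L f)
  ... | false = begin
    ∑ (filterᵇ p L) f                          ≡⟨ ∑-filter p L f ⟩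
    ∑[ z ∈ L ] (ind (p z) * f z)              ≡⟨ sym (+-identityˡ _) ⟩
    0# + ∑[ z ∈ L ] (ind (p z) * f z)         ≡⟨ cong (_+ ∑[ z ∈ L ] (ind (p z) * f z)) (sym (zeroˡ (f x))) ⟩
    0# * f x + ∑[ z ∈ L ] (ind (p z) * f z)   ∎

  ∑-restrict : {B : Set} (p : B → Bool) (L : List B) (f : B → Carrier) →
    (∀ z → z ∈ L → p z ≡ false → f z ≡ 0#) → ∑ (filterᵇ p L) f ≡ ∑ L f
  ∑-restrict p L f h = trans (∑-filter p L f) (∑-cong L (λ z z∈ → keep z z∈ (p z) refl))
    where
    keep : ∀ z → z ∈ L → (b : Bool) → p z ≡ b → ind b * f z ≡ f z
    keep z z∈ true _ = *-identityˡ (f z)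
    keep z z∈ false pz = trans (zeroˡ (f z)) (sym (h z z∈ pz))

  ∑-delta : {B : Set} (E : B → B → Bool) → (∀ x y → E x y ≡ true → x ≡ y) → (∀ x → E x x ≡ true) →
    ∀ (K : List B) → Nodup K → ∀ {y} → y ∈ K → (f : B → Carrier) → ∑[ w ∈ K ] (ind (E w y) * f w) ≡ f y
  ∑-delta E sound refl' (x ∷ K) (x∉ ∷ nd) (here refl) f rewrite refl' x =
    trans (cong₂ _+_ (*-identityˡ (f x)) (∑-zero K off)) (+-identityʳ (f x))
    where
    off : ∀ w → w ∈ K → ind (E w x) * f w ≡ 0#
    off w w∈ with E w x in e
    ... | true = ⊥-elim (x∉ (subst (_∈ K) (sound w x e) w∈))
    ... | false = zeroˡ (f w)
  ∑-delta E sound refl' (x ∷ K) (x∉ ∷ nd) {y} (there y∈) f with E x y in e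
  ... | true = ⊥-elim (x∉ (subst (_∈ K) (sym (sound x y e)) y∈))
  ... | false = trans (cong₂ _+_ (zeroˡ (f x)) (∑-delta E sound refl' K nd y∈ f)) (+-identityˡ (f y))

module ℤΣ = ListSum ℤP.+-*-commutativeRing (λ e → e)
module ℚΣ = ListSum ℚP.+-*-commutativeRing (λ e → e)

-- Counting filtered elements: shrinking the predicate shrinks the count,
-- strictly if some element is lost.  This is the termination measure for
-- the Möbius recursion.

filter-mono : {A : Set} (p q : A → Bool) (L : List A) → (∀ w → w ∈ L → p w ≡ true → q w ≡ true) →
  length (filterᵇ p L) ≤ length (filterᵇ q L)
filter-mono p q [] p⇒q = z≤n
filter-mono p q (x ∷ L) p⇒q with p x in px | q x in qx
... | true | true = s≤s (filter-mono p q L (λ w w∈ → p⇒q w (there w∈)))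
... | true | false = ⊥-elim (true≢false (trans (sym (p⇒q x (here refl) px)) qx))
... | false | true = ℕP.m≤n⇒m≤1+n (filter-mono p q L (λ w w∈ → p⇒q w (there w∈)))
... | false | false = filter-mono p q L (λ w w∈ → p⇒q w (there w∈))

filter-strict : {A : Set} (p q : A → Bool) (L : List A) → (∀ w → w ∈ L → p w ≡ true → q w ≡ true) →
  ∀ {z} → z ∈ L → q z ≡ true → p z ≡ false → length (filterᵇ p L) < length (filterᵇ q L)
filter-strict p q (x ∷ L) p⇒q (here refl) qz pz rewrite qz | pz =
  s≤s (filter-mono p q L (λ w w∈ → p⇒q w (there w∈)))
filter-strict p q (x ∷ L) p⇒q (there z∈) qz pz with p x in px | q x in qx
... | true | true = s≤s (filter-strict p q L (λ w w∈ → p⇒q w (there w∈)) z∈ qz pz)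
... | true | false = ⊥-elim (true≢false (trans (sym (p⇒q x (here refl) px)) qx))
... | false | true = ℕP.m≤n⇒m≤1+n (filter-strict p q L (λ w w∈ → p⇒q w (there w∈)) z∈ qz pz)
... | false | false = filter-strict p q L (λ w w∈ → p⇒q w (there w∈)) z∈ qz pz

record FinitePoset (A : Set) : Set where
  field
    E R : A → A → Bool
    L : List A
    E-sound : ∀ x y → E x y ≡ true → x ≡ y
    E-refl : ∀ x → E x x ≡ true
    R-refl : ∀ {x} → x ∈ L → R x x ≡ true
    R-trans : ∀ {x y z} → R x y ≡ true → R y z ≡ true → R x z ≡ true
    R-antisym : ∀ {x y} → x ∈ L → y ∈ L → R x y ≡ true → R y x ≡ true → x ≡ y
    L-nodup : Nodup L

dual : {A : Set} → FinitePoset A → FinitePoset A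
dual P = record
  { E = E ; R = λ x y → R y x ; L = L ; E-sound = E-sound ; E-refl = E-refl ; R-refl = R-refl
  ; R-trans = λ x≥y y≥z → R-trans y≥z x≥y ; R-antisym = λ x∈ y∈ y≤x x≤y → R-antisym x∈ y∈ x≤y y≤x
  ; L-nodup = L-nodup }
  where open FinitePoset P

-- The Möbius function of a finite poset, defined by the recursion
-- μ(x,x) = 1, μ(x,y) = - Σ_{x ≤ z < y} μ(x,z) for x < y, and 0 otherwise
-- (with fuel |L|, which exceeds every interval); we prove the inversion
-- formula  Σ_z μ(x,z) [z ≤ y] = [x = y].

module Möbius {A : Set} (P : FinitePoset A) where

  open FinitePoset P

  open ℤΣ using (∑; ind)
  open ≡-Reasoning

  between : A → A → A → Bool
  between x y z = R x z ∧ (R z y ∧ not (E z y))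

  μ-fuel : ℕ → A → A → ℤ
  μ-fuel zero x y = ℤ.+ 0
  μ-fuel (suc f) x y = if E x y then ℤ.+ 1
    else if R x y then ℤ.- ∑ (filterᵇ (between x y) L) (μ-fuel f x)
    else ℤ.+ 0

  μ : A → A → ℤ
  μ = μ-fuel (length L)

  E-false : ∀ {x y} → x ≢ y → E x y ≡ false
  E-false {x} {y} x≢y with E x y in e
  ... | true = ⊥-elim (x≢y (E-sound x y e))
  ... | false = refl

  E-sym : ∀ x y → E x y ≡ E y x
  E-sym = boolEq-sym E E-sound E-refl

  ∑-delta : ∀ {y} → y ∈ L → (f : A → ℤ) → ∑[ w ∈ L ] (ind (E w y) ℤ.* f w) ≡ f y
  ∑-delta = ℤΣ.∑-delta E E-sound E-refl L L-nodup

  between-elim : ∀ {x y z} → between x y z ≡ true → R x z ≡ true × R z y ≡ true × z ≢ y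
  between-elim {x} {y} {z} b with R x z | R z y | E z y in e | b
  ... | true | true | false | _ = refl , refl , λ z≡y → true≢false (trans (sym (E-refl z)) (trans (cong (E z) z≡y) e))

  between-self : ∀ x y → between x y y ≡ false
  between-self x y rewrite E-refl y | ∧-zeroʳ (R y y) = ∧-zeroʳ (R x y)

  width : A → A → ℕ
  width x y = length (filterᵇ (between x y) L)

  width-decreases : ∀ {x y z} → y ∈ L → z ∈ filterᵇ (between x y) L → width x z < width x y
  width-decreases {x} {y} {z} y∈ z∈ =
    filter-strict (between x z) (between x y) L inside z∈L xzy (between-self x z)
    where
    z∈L = proj₁ (filter-∈⁻ (between x y) L z∈)
    xzy = proj₂ (filter-∈⁻ (between x y) L z∈)
    inside : ∀ w → w ∈ L → between x z w ≡ true → between x y w ≡ true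
    inside w _ xwz with between-elim xwz | between-elim xzy
    ... | xw , wz , _ | _ , zy , z≢y rewrite xw | R-trans wz zy =
      cong not (E-false λ w≡y → z≢y (R-antisym z∈L y∈ zy (subst (λ t → R t z ≡ true) w≡y wz)))

  width< : ∀ x {y} → y ∈ L → width x y < length L
  width< x {y} y∈ = ListP.filter-notAll (T? ∘ between x y) L (Any.map (λ { refl → subst T (between-self x y) }) y∈)

  μ-off-order : ∀ f {x y} → x ∈ L → R x y ≡ false → μ-fuel f x y ≡ ℤ.+ 0
  μ-off-order zero x∈ x≰y = refl
  μ-off-order (suc f) {x} {y} x∈ x≰y with E x y in e
  ... | true = ⊥-elim (true≢false (trans (sym (R-refl x∈)) (trans (cong (R x) (E-sound x y e)) x≰y)))
  ... | false rewrite x≰y = refl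

  μ-fuel-stable : ∀ f g x {y} → y ∈ L → width x y < f → width x y < g → μ-fuel f x y ≡ μ-fuel g x y
  μ-fuel-stable (suc f) (suc g) x {y} y∈ w<f w<g with E x y
  ... | true = refl
  ... | false with R x y
  ... | false = refl
  ... | true = cong ℤ.-_ (ℤΣ.∑-cong (filterᵇ (between x y) L) λ z z∈ →
    μ-fuel-stable f g x (proj₁ (filter-∈⁻ (between x y) L z∈))
      (ℕP.<-≤-trans (width-decreases y∈ z∈) (ℕP.≤-pred w<f))
      (ℕP.<-≤-trans (width-decreases y∈ z∈) (ℕP.≤-pred w<g)))

  μ-diag : ∀ {x} → x ∈ L → μ x x ≡ ℤ.+ 1
  μ-diag {x} x∈ with length L | width< x x∈
  ... | suc _ | _ rewrite E-refl x = refl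

  μ-recursion : ∀ {x y} → y ∈ L → E x y ≡ false → R x y ≡ true →
    μ x y ℤ.+ ∑ (filterᵇ (between x y) L) (μ x) ≡ ℤ.+ 0
  μ-recursion {x} {y} y∈ x≢y x≤y with length L | width< x y∈
  ... | suc f | w<L rewrite x≢y | x≤y =
    trans (cong (λ t → (ℤ.- S) ℤ.+ t) (ℤΣ.∑-cong (filterᵇ (between x y) L) λ z z∈ →
            μ-fuel-stable (suc f) f x (proj₁ (filter-∈⁻ (between x y) L z∈))
              (ℕP.<-≤-trans (width-decreases y∈ z∈) (ℕP.m≤n⇒m≤1+n (ℕP.≤-pred w<L)))
              (ℕP.<-≤-trans (width-decreases y∈ z∈) (ℕP.≤-pred w<L))))
      (ℤΣ.-‿inverseˡ S)
    where
    S = ∑ (filterᵇ (between x y) L) (μ-fuel f x)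

  μζ-summand : ∀ {x} → x ∈ L → ∀ y {z} → z ∈ L →
    μ x z ℤ.* ind (R z y) ≡ ind (E z y) ℤ.* μ x y ℤ.+ ind (between x y z) ℤ.* μ x z
  μζ-summand {x} x∈ y {z} z∈ with E z y in e
  ... | true with E-sound z y e
  ...   | refl rewrite R-refl z∈ | ∧-zeroʳ (R x z) =
    trans (ℤΣ.*-identityʳ (μ x z)) (sym (trans (cong₂ ℤ._+_ (ℤΣ.*-identityˡ (μ x z)) (ℤΣ.zeroˡ (μ x z))) (ℤΣ.+-identityʳ (μ x z))))
  μζ-summand {x} x∈ y {z} z∈ | false rewrite ∧-identityʳ (R z y) with R x z in x≤z
  ... | true = trans (ℤΣ.*-comm (μ x z) (ind (R z y))) (sym (ℤΣ.+-identityˡ _))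
  ... | false rewrite μ-off-order (length L) x∈ x≤z = refl

  μ-ζ : ∀ {x y} → x ∈ L → y ∈ L → ∑[ z ∈ L ] (μ x z ℤ.* ind (R z y)) ≡ ind (E x y)
  μ-ζ {x} {y} x∈ y∈ with R x y in x≤y
  ... | false = trans (ℤΣ.∑-zero L vanish) (cong ind (sym (E-false x≢y)))
    where
    x≢y : x ≢ y
    x≢y refl = true≢false (trans (sym (R-refl x∈)) x≤y)
    vanish : ∀ z → z ∈ L → μ x z ℤ.* ind (R z y) ≡ ℤ.+ 0
    vanish z _ with R x z in x≤z
    ... | false rewrite μ-off-order (length L) x∈ x≤z = refl
    ... | true with R z y in z≤y
    ...   | true = ⊥-elim (true≢false (trans (sym (R-trans x≤z z≤y)) x≤y))
    ...   | false = ℤΣ.zeroʳ (μ x z)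
  ... | true = begin
    ∑[ z ∈ L ] (μ x z ℤ.* ind (R z y))
      ≡⟨ ℤΣ.∑-cong L (λ z z∈ → μζ-summand x∈ y z∈) ⟩
    ∑[ z ∈ L ] (ind (E z y) ℤ.* μ x y ℤ.+ ind (between x y z) ℤ.* μ x z)
      ≡⟨ ℤΣ.∑-+ L _ _ ⟩
    ∑[ z ∈ L ] (ind (E z y) ℤ.* μ x y) ℤ.+ ∑[ z ∈ L ] (ind (between x y z) ℤ.* μ x z)
      ≡⟨ cong₂ ℤ._+_ (∑-delta y∈ (λ _ → μ x y)) (sym (ℤΣ.∑-filter (between x y) L (μ x))) ⟩
    μ x y ℤ.+ ∑ (filterᵇ (between x y) L) (μ x)
      ≡⟨ diagonal-or-recursion (E x y) refl ⟩
    ind (E x y) ∎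
    where
    diagonal-or-recursion : ∀ b → E x y ≡ b → μ x y ℤ.+ ∑ (filterᵇ (between x y) L) (μ x) ≡ ind b
    diagonal-or-recursion false x≢y = μ-recursion y∈ x≢y x≤y
    diagonal-or-recursion true x≡y with E-sound x y x≡y
    ... | refl = trans (cong₂ ℤ._+_ (μ-diag x∈) (ℤΣ.∑-zero _ empty)) (ℤΣ.+-identityʳ (ℤ.+ 1))
      where
      empty : ∀ z → z ∈ filterᵇ (between x x) L → μ x z ≡ ℤ.+ 0
      empty z z∈ with filter-∈⁻ (between x x) L z∈
      ... | z∈L , xzx with between-elim xzx
      ...   | x≤z , z≤x , z≢x = ⊥-elim (z≢x (R-antisym z∈L x∈ z≤x x≤z))

-- It follows from the one-sided formula for the dual order: the Möbius
-- function ν of the dual satisfies ν ⋆ ζ = δ on the other side, and μ = ν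
-- by associativity of the convolution μ ⋆ ζ ⋆ ν.

module MöbiusInversion {A : Set} (P : FinitePoset A) where

  open FinitePoset P
  open Möbius P public
  private
    module Dual = Möbius (dual P)

  open ℤΣ using (∑; ind)
  open ≡-Reasoning

  μ≡dual : ∀ {x y} → x ∈ L → y ∈ L → μ x y ≡ Dual.μ y x
  μ≡dual {x} {y} x∈ y∈ = begin
    μ x y
      ≡⟨ sym (∑-delta y∈ (μ x)) ⟩
    ∑[ w ∈ L ] (ind (E w y) ℤ.* μ x w)
      ≡⟨ ℤΣ.∑-cong L (λ w w∈ → trans (ℤΣ.*-comm (ind (E w y)) (μ x w)) (cong (μ x w ℤ.*_) (dual-ζ w∈))) ⟩
    ∑[ w ∈ L ] (μ x w ℤ.* ∑[ z ∈ L ] (ν z ℤ.* ind (R w z)))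
      ≡⟨ ℤΣ.∑-cong L (λ w _ → ℤΣ.∑-*ˡ L (μ x w) _) ⟩
    ∑[ w ∈ L ] ∑[ z ∈ L ] (μ x w ℤ.* (ν z ℤ.* ind (R w z)))
      ≡⟨ ℤΣ.∑-comm L L _ ⟩
    ∑[ z ∈ L ] ∑[ w ∈ L ] (μ x w ℤ.* (ν z ℤ.* ind (R w z)))
      ≡⟨ ℤΣ.∑-cong L (λ z _ → ℤΣ.∑-cong L λ w _ → regroup (μ x w) (ν z) (ind (R w z))) ⟩
    ∑[ z ∈ L ] ∑[ w ∈ L ] ((μ x w ℤ.* ind (R w z)) ℤ.* ν z)
      ≡⟨ ℤΣ.∑-cong L (λ z z∈ → trans (sym (ℤΣ.∑-*ʳ L (ν z) _)) (cong (ℤ._* ν z) (μ-ζ' z∈))) ⟩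
    ∑[ z ∈ L ] (ind (E z x) ℤ.* ν z)
      ≡⟨ ∑-delta x∈ ν ⟩
    ν x ∎
    where
    ν : A → ℤ
    ν z = Dual.μ y z
    dual-ζ : ∀ {w} → w ∈ L → ind (E w y) ≡ ∑[ z ∈ L ] (ν z ℤ.* ind (R w z))
    dual-ζ w∈ = trans (cong ind (E-sym _ _)) (sym (Dual.μ-ζ y∈ w∈))
    μ-ζ' : ∀ {z} → z ∈ L → ∑[ w ∈ L ] (μ x w ℤ.* ind (R w z)) ≡ ind (E z x)
    μ-ζ' z∈ = trans (μ-ζ x∈ z∈) (cong ind (E-sym _ _))
    regroup : ∀ a b c → a ℤ.* (b ℤ.* c) ≡ (a ℤ.* c) ℤ.* b
    regroup a b c = trans (cong (a ℤ.*_) (ℤΣ.*-comm b c)) (sym (ℤΣ.*-assoc a c b))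

  ζ-μ : ∀ {x y} → x ∈ L → y ∈ L → ∑[ z ∈ L ] (ind (R x z) ℤ.* μ z y) ≡ ind (E x y)
  ζ-μ {x} {y} x∈ y∈ = begin
    ∑[ z ∈ L ] (ind (R x z) ℤ.* μ z y)
      ≡⟨ ℤΣ.∑-cong L (λ z z∈ → trans (ℤΣ.*-comm (ind (R x z)) (μ z y)) (cong (ℤ._* ind (R x z)) (μ≡dual z∈ y∈))) ⟩
    ∑[ z ∈ L ] (Dual.μ y z ℤ.* ind (R x z))
      ≡⟨ Dual.μ-ζ y∈ x∈ ⟩
    ind (E y x)
      ≡⟨ cong ind (E-sym y x) ⟩
    ind (E x y) ∎

record JoinClosedUpSet {A : Set} (P : FinitePoset A) : Set where
  open FinitePoset P
  field
    inU : A → Bool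
    inU-up : ∀ {x y} → y ∈ L → inU x ≡ true → R x y ≡ true → inU y ≡ true
    _⊔_ : A → A → A
    ⊔-closed : ∀ {x y} → x ∈ filterᵇ inU L → y ∈ filterᵇ inU L → (x ⊔ y) ∈ filterᵇ inU L
    ⊔-char : ∀ {x y z} → x ∈ filterᵇ inU L → y ∈ filterᵇ inU L → z ∈ L → R (x ⊔ y) z ≡ R x z ∧ R y z

module JoinFactorisation {A : Set} (P : FinitePoset A) (J : JoinClosedUpSet P) (f : A → ℤ) where

  open FinitePoset P
  open JoinClosedUpSet J
  open MöbiusInversion P public
  open ℤΣ using (∑; ind)
  open ≡-Reasoning

  U : List A
  U = filterᵇ inU L

  U⊆L : ∀ {x} → x ∈ U → x ∈ L
  U⊆L x∈ = proj₁ (filter-∈⁻ inU L x∈)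

  U-nodup : Nodup U
  U-nodup = filter-nodup inU L L-nodup

  above-U : ∀ {x y} → x ∈ U → y ∈ L → inU y ≡ false → R x y ≡ false
  above-U {x} {y} x∈ y∈ y∉U with R x y in x≤y
  ... | true = ⊥-elim (true≢false (trans (sym (inU-up y∈ (proj₂ (filter-∈⁻ inU L x∈)) x≤y)) y∉U))
  ... | false = refl

  ∑-deltaU : ∀ {y} → y ∈ U → (g : A → ℤ) → ∑[ w ∈ U ] (ind (E y w) ℤ.* g w) ≡ g y
  ∑-deltaU {y} y∈ g = trans (ℤΣ.∑-cong U (λ w _ → cong (λ b → ind b ℤ.* g w) (E-sym y w)))
    (ℤΣ.∑-delta E E-sound E-refl U U-nodup y∈ g)

  ζ-μ-U : ∀ {ρ σ} → ρ ∈ U → σ ∈ U → ∑[ τ ∈ U ] (ind (R ρ τ) ℤ.* μ τ σ) ≡ ind (E ρ σ)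
  ζ-μ-U {ρ} {σ} ρ∈ σ∈ = trans (ℤΣ.∑-restrict inU L _ outside) (ζ-μ (U⊆L ρ∈) (U⊆L σ∈))
    where
    outside : ∀ τ → τ ∈ L → inU τ ≡ false → ind (R ρ τ) ℤ.* μ τ σ ≡ ℤ.+ 0
    outside τ τ∈ τ∉U rewrite above-U ρ∈ τ∈ τ∉U = ℤΣ.zeroˡ (μ τ σ)

  μ-ζ-U : ∀ {t s} → t ∈ U → s ∈ U → ∑[ σ ∈ U ] (μ t σ ℤ.* ind (R σ s)) ≡ ind (E t s)
  μ-ζ-U {t} {s} t∈ s∈ = trans (ℤΣ.∑-restrict inU L _ outside) (μ-ζ (U⊆L t∈) (U⊆L s∈))
    where
    outside : ∀ σ → σ ∈ L → inU σ ≡ false → μ t σ ℤ.* ind (R σ s) ≡ ℤ.+ 0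
    outside σ σ∈ σ∉U rewrite μ-off-order (length L) (U⊆L t∈) (above-U t∈ σ∈ σ∉U) = refl

  lam : A → ℤ
  lam τ = ∑[ σ ∈ U ] (μ τ σ ℤ.* f σ)

  lam-inversion : ∀ {ρ} → ρ ∈ U → ∑[ τ ∈ U ] (ind (R ρ τ) ℤ.* lam τ) ≡ f ρ
  lam-inversion {ρ} ρ∈ = begin
    ∑[ τ ∈ U ] (ind (R ρ τ) ℤ.* lam τ)
      ≡⟨ ℤΣ.∑-cong U (λ τ _ → ℤΣ.∑-*ˡ U (ind (R ρ τ)) _) ⟩
    ∑[ τ ∈ U ] ∑[ σ ∈ U ] (ind (R ρ τ) ℤ.* (μ τ σ ℤ.* f σ))
      ≡⟨ ℤΣ.∑-comm U U _ ⟩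
    ∑[ σ ∈ U ] ∑[ τ ∈ U ] (ind (R ρ τ) ℤ.* (μ τ σ ℤ.* f σ))
      ≡⟨ ℤΣ.∑-cong U (λ σ _ → trans (ℤΣ.∑-cong U (λ τ _ → sym (ℤΣ.*-assoc (ind (R ρ τ)) (μ τ σ) (f σ))))
                                      (sym (ℤΣ.∑-*ʳ U (f σ) _))) ⟩
    ∑[ σ ∈ U ] (∑[ τ ∈ U ] (ind (R ρ τ) ℤ.* μ τ σ) ℤ.* f σ)
      ≡⟨ ℤΣ.∑-cong U (λ σ σ∈ → cong (ℤ._* f σ) (ζ-μ-U ρ∈ σ∈)) ⟩
    ∑[ σ ∈ U ] (ind (E ρ σ) ℤ.* f σ)
      ≡⟨ ∑-deltaU ρ∈ f ⟩
    f ρ ∎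

  join-factorisation : ∀ {ρ ρ'} → ρ ∈ U → ρ' ∈ U →
    f (ρ ⊔ ρ') ≡ ∑[ τ ∈ U ] (ind (R ρ τ) ℤ.* (ind (R ρ' τ) ℤ.* lam τ))
  join-factorisation {ρ} {ρ'} ρ∈ ρ'∈ =
    trans (sym (lam-inversion (⊔-closed ρ∈ ρ'∈))) (ℤΣ.∑-cong U λ τ τ∈ → begin
      ind (R (ρ ⊔ ρ') τ) ℤ.* lam τ           ≡⟨ cong (λ b → ind b ℤ.* lam τ) (⊔-char ρ∈ ρ'∈ (U⊆L τ∈)) ⟩
      ind (R ρ τ ∧ R ρ' τ) ℤ.* lam τ          ≡⟨ cong (ℤ._* lam τ) (ℤΣ.ind-∧ (R ρ τ) (R ρ' τ)) ⟩
      (ind (R ρ τ) ℤ.* ind (R ρ' τ)) ℤ.* lam τ ≡⟨ ℤΣ.*-assoc (ind (R ρ τ)) (ind (R ρ' τ)) (lam τ) ⟩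
      ind (R ρ τ) ℤ.* (ind (R ρ' τ) ℤ.* lam τ) ∎)

  ⊔-comm : ∀ {ρ ρ'} → ρ ∈ U → ρ' ∈ U → ρ ⊔ ρ' ≡ ρ' ⊔ ρ
  ⊔-comm {ρ} {ρ'} ρ∈ ρ'∈ = R-antisym (U⊆L (⊔-closed ρ∈ ρ'∈)) (U⊆L (⊔-closed ρ'∈ ρ∈)) (below ρ∈ ρ'∈) (below ρ'∈ ρ∈)
    where
    below : ∀ {x y} → x ∈ U → y ∈ U → R (x ⊔ y) (y ⊔ x) ≡ true
    below {x} {y} x∈ y∈ = trans (⊔-char x∈ y∈ (U⊆L (⊔-closed y∈ x∈)))
      (trans (∧-comm (R x (y ⊔ x)) (R y (y ⊔ x)))
        (trans (sym (⊔-char y∈ x∈ (U⊆L (⊔-closed y∈ x∈)))) (R-refl (U⊆L (⊔-closed y∈ x∈)))))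

  join-kernel : ∀ {t ρ} → t ∈ U → ρ ∈ U → ∑[ σ ∈ U ] (f (ρ ⊔ σ) ℤ.* μ t σ) ≡ ind (R ρ t) ℤ.* lam t
  join-kernel {t} {ρ} t∈ ρ∈ = begin
    ∑[ σ ∈ U ] (f (ρ ⊔ σ) ℤ.* μ t σ)
      ≡⟨ ℤΣ.∑-cong U (λ σ σ∈ → trans (cong (ℤ._* μ t σ) (join-factorisation ρ∈ σ∈)) (ℤΣ.∑-*ʳ U (μ t σ) _)) ⟩
    ∑[ σ ∈ U ] ∑[ τ ∈ U ] ((ind (R ρ τ) ℤ.* (ind (R σ τ) ℤ.* lam τ)) ℤ.* μ t σ)
      ≡⟨ ℤΣ.∑-comm U U _ ⟩
    ∑[ τ ∈ U ] ∑[ σ ∈ U ] ((ind (R ρ τ) ℤ.* (ind (R σ τ) ℤ.* lam τ)) ℤ.* μ t σ)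
      ≡⟨ ℤΣ.∑-cong U (λ τ _ → trans (ℤΣ.∑-cong U (λ σ _ → regroup (ind (R ρ τ)) (ind (R σ τ)) (lam τ) (μ t σ)))
                                      (sym (ℤΣ.∑-*ˡ U (ind (R ρ τ) ℤ.* lam τ) _))) ⟩
    ∑[ τ ∈ U ] ((ind (R ρ τ) ℤ.* lam τ) ℤ.* ∑[ σ ∈ U ] (μ t σ ℤ.* ind (R σ τ)))
      ≡⟨ ℤΣ.∑-cong U (λ τ τ∈ → trans (cong ((ind (R ρ τ) ℤ.* lam τ) ℤ.*_) (μ-ζ-U t∈ τ∈))
                                      (ℤΣ.*-comm (ind (R ρ τ) ℤ.* lam τ) (ind (E t τ)))) ⟩
    ∑[ τ ∈ U ] (ind (E t τ) ℤ.* (ind (R ρ τ) ℤ.* lam τ))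
      ≡⟨ ∑-deltaU t∈ (λ τ → ind (R ρ τ) ℤ.* lam τ) ⟩
    ind (R ρ t) ℤ.* lam t ∎
    where
    open import Data.Integer.Solver using (module +-*-Solver)
    open +-*-Solver
    regroup : ∀ a b l u → (a ℤ.* (b ℤ.* l)) ℤ.* u ≡ (a ℤ.* l) ℤ.* (u ℤ.* b)
    regroup = solve 4 (λ a b l u → (a :* (b :* l)) :* u := (a :* l) :* (u :* b)) refl

ι : ℤ → ℚ
ι a = a ℚ./ 1

private
  ι-unnormalised : ∀ a → ℚ.toℚᵘ (ι a) ℚᵘ.≃ mkℚᵘ a 0
  ι-unnormalised a = ℚP.toℚᵘ-fromℚᵘ (mkℚᵘ a 0)

ι-+ : ∀ a b → ι (a ℤ.+ b) ≡ ι a ℚ.+ ι b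
ι-+ a b = ℚP.toℚᵘ-injective (ℚᵘP.≃-trans (ι-unnormalised (a ℤ.+ b)) (ℚᵘP.≃-trans sum-is-sum
   (ℚᵘP.≃-sym (ℚᵘP.≃-trans (ℚP.toℚᵘ-homo-+ (ι a) (ι b)) (ℚᵘP.+-cong (ι-unnormalised a) (ι-unnormalised b))))))
  where
  sum-is-sum : mkℚᵘ (a ℤ.+ b) 0 ℚᵘ.≃ (mkℚᵘ a 0 ℚᵘ.+ mkℚᵘ b 0)
  sum-is-sum = *≡* (trans (ℤP.*-identityʳ (a ℤ.+ b)) (sym (trans (ℤP.*-identityʳ _)
                 (cong₂ ℤ._+_ (ℤP.*-identityʳ a) (ℤP.*-identityʳ b)))))

ι-* : ∀ a b → ι (a ℤ.* b) ≡ ι a ℚ.* ι b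
ι-* a b = ℚP.toℚᵘ-injective (ℚᵘP.≃-trans (ι-unnormalised (a ℤ.* b)) (ℚᵘP.≃-trans (*≡* refl)
   (ℚᵘP.≃-sym (ℚᵘP.≃-trans (ℚP.toℚᵘ-homo-* (ι a) (ι b)) (ℚᵘP.*-cong (ι-unnormalised a) (ι-unnormalised b))))))

ι-zero : ∀ a → ι a ≡ ℚ.0ℚ → a ≡ ℤ.+ 0
ι-zero a e with ℚᵘP.≃-trans (ℚᵘP.≃-sym (ι-unnormalised a)) (ℚᵘP.≃-trans (ℚP.toℚᵘ-cong e) (ι-unnormalised (ℤ.+ 0)))
... | *≡* a*1≡0 = trans (sym (ℤP.*-identityʳ a)) a*1≡0

ι-ind : ∀ b → ι (ℤΣ.ind b) ≡ ℚΣ.ind b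
ι-ind true = refl
ι-ind false = refl

ι-∑ : {A : Set} (K : List A) (g : A → ℤ) → ι (ℤΣ.∑ K g) ≡ ℚΣ.∑ K (λ a → ι (g a))
ι-∑ [] g = refl
ι-∑ (x ∷ K) g = trans (ι-+ (g x) (ℤΣ.∑ K g)) (cong (ι (g x) ℚ.+_) (ι-∑ K g))

-- the reciprocal of a rational, 0 at 0
recip : ℚ → ℚ
recip q with q ℚP.≟ ℚ.0ℚ
... | yes _ = ℚ.0ℚ
... | no q≢0 = ℚ.1/_ q {{ℚ.≢-nonZero q≢0}}

recip-inverse : ∀ q → q ≢ ℚ.0ℚ → recip q ℚ.* q ≡ ℚ.1ℚ
recip-inverse q q≢0 with q ℚP.≟ ℚ.0ℚ
... | yes q≡0 = ⊥-elim (q≢0 q≡0)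
... | no q≢0' = ℚP.*-inverseˡ q {{ℚ.≢-nonZero q≢0'}}

module ℚSum = SemiringSum (CommutativeRing.semiring ℚP.+-*-commutativeRing)

sumFin≡sum : ∀ p (f : Fin p → ℚ) → sumFin p f ≡ ℚSum.sum f
sumFin≡sum zero f = refl
sumFin≡sum (suc p) f = cong (f Fin.zero ℚ.+_) (sumFin≡sum p (f ∘ Fin.suc))

sumFin-cong : ∀ p {f h : Fin p → ℚ} → (∀ j → f j ≡ h j) → sumFin p f ≡ sumFin p h
sumFin-cong p {f} {h} f≗h = trans (sumFin≡sum p f) (trans (ℚSum.sum-cong-≗ f≗h) (sym (sumFin≡sum p h)))

sumFin-zero : ∀ p {f : Fin p → ℚ} → (∀ j → f j ≡ ℚ.0ℚ) → sumFin p f ≡ ℚ.0ℚ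
sumFin-zero zero f≗0 = refl
sumFin-zero (suc p) f≗0 = cong₂ ℚ._+_ (f≗0 Fin.zero) (sumFin-zero p (f≗0 ∘ Fin.suc))

sumFin-*ˡ : ∀ p c (f : Fin p → ℚ) → c ℚ.* sumFin p f ≡ sumFin p (λ j → c ℚ.* f j)
sumFin-*ˡ p c f = trans (cong (c ℚ.*_) (sumFin≡sum p f)) (trans (ℚSum.*-distribˡ-sum c f) (sym (sumFin≡sum p _)))

sumFin-*ʳ : ∀ p c (f : Fin p → ℚ) → sumFin p f ℚ.* c ≡ sumFin p (λ j → f j ℚ.* c)
sumFin-*ʳ p c f = trans (cong (ℚ._* c) (sumFin≡sum p f)) (trans (ℚSum.*-distribʳ-sum c f) (sym (sumFin≡sum p _)))

sumFin-comm : ∀ p q (f : Fin p → Fin q → ℚ) →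
  sumFin p (λ i → sumFin q (f i)) ≡ sumFin q (λ j → sumFin p (λ i → f i j))
sumFin-comm p q f = begin
  sumFin p (λ i → sumFin q (f i))              ≡⟨ sumFin-cong p (λ i → sumFin≡sum q (f i)) ⟩
  sumFin p (λ i → ℚSum.sum (f i))              ≡⟨ sumFin≡sum p _ ⟩
  ℚSum.sum (λ i → ℚSum.sum (f i))              ≡⟨ ℚSum.∑-comm f ⟩
  ℚSum.sum (λ j → ℚSum.sum (λ i → f i j))      ≡⟨ sym (sumFin≡sum q _) ⟩
  sumFin q (λ j → ℚSum.sum (λ i → f i j))      ≡⟨ sumFin-cong q (λ j → sym (sumFin≡sum p _)) ⟩
  sumFin q (λ j → sumFin p (λ i → f i j))      ∎
  where open ≡-Reasoning

·-apply : ∀ {p} (Y X : Matrix p) (x : Fin p → ℚ) i →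
  sumFin p (λ j → (Y · X) i j ℚ.* x j) ≡ sumFin p (λ k → Y i k ℚ.* sumFin p (λ j → X k j ℚ.* x j))
·-apply {p} Y X x i = begin
  sumFin p (λ j → (Y · X) i j ℚ.* x j)
    ≡⟨ sumFin-cong p (λ j → sumFin-*ʳ p (x j) (λ k → Y i k ℚ.* X k j)) ⟩
  sumFin p (λ j → sumFin p (λ k → (Y i k ℚ.* X k j) ℚ.* x j))
    ≡⟨ sumFin-comm p p _ ⟩
  sumFin p (λ k → sumFin p (λ j → (Y i k ℚ.* X k j) ℚ.* x j))
    ≡⟨ sumFin-cong p (λ k → trans (sumFin-cong p (λ j → ℚP.*-assoc (Y i k) (X k j) (x j))) (sym (sumFin-*ˡ p (Y i k) _))) ⟩
  sumFin p (λ k → Y i k ℚ.* sumFin p (λ j → X k j ℚ.* x j)) ∎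
  where open ≡-Reasoning

I-sym : ∀ {p} (i j : Fin p) → I i j ≡ I j i
I-sym i j = cong (λ b → if b then ℚ.1ℚ else ℚ.0ℚ)
  (boolEq-sym _==F_ (λ _ _ → ==F-sound) (λ _ → ==F-complete refl) i j)

symmetric-inverse : ∀ {p} (X Y : Matrix p) → (∀ i j → X i j ≡ X j i) → (∀ i j → Y i j ≡ Y j i) →
  (∀ i j → (X · Y) i j ≡ I i j) → ∀ i j → (Y · X) i j ≡ I i j
symmetric-inverse {p} X Y X-sym Y-sym XY≡I i j =
  trans (sumFin-cong p (λ k → trans (ℚP.*-comm (Y i k) (X k j)) (cong₂ ℚ._*_ (X-sym k j) (Y-sym i k))))
        (trans (XY≡I j i) (I-sym j i))

module ListIndexed {A : Set} (E : A → A → Bool)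
  (E-sound : ∀ x y → E x y ≡ true → x ≡ y) (E-refl : ∀ x → E x x ≡ true)
  (K : List A) (K-nodup : Nodup K) where

  p : ℕ
  p = length K

  lk : Fin p → A
  lk = List.lookup K

  lk-injective : ∀ {i j} → lk i ≡ lk j → i ≡ j
  lk-injective = go K K-nodup
    where
    go : (K : List A) → Nodup K → ∀ {i j} → List.lookup K i ≡ List.lookup K j → i ≡ j
    go (x ∷ K) nd {Fin.zero} {Fin.zero} e = refl
    go (x ∷ K) (x∉ ∷ nd) {Fin.zero} {Fin.suc j} e = ⊥-elim (x∉ (subst (_∈ K) (sym e) (∈-lookup j)))
    go (x ∷ K) (x∉ ∷ nd) {Fin.suc i} {Fin.zero} e = ⊥-elim (x∉ (subst (_∈ K) e (∈-lookup i)))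
    go (x ∷ K) (x∉ ∷ nd) {Fin.suc i} {Fin.suc j} e = cong Fin.suc (go K nd e)

  sumFin-lookup : (g : A → ℚ) → sumFin p (λ i → g (lk i)) ≡ ℚΣ.∑ K g
  sumFin-lookup g = go K
    where
    go : (K : List A) → sumFin (length K) (λ i → g (List.lookup K i)) ≡ ℚΣ.∑ K g
    go [] = refl
    go (x ∷ K) = cong (g x ℚ.+_) (go K)

  I-lookup : ∀ i j → I {p} i j ≡ ℚΣ.ind (E (lk i) (lk j))
  I-lookup i j = trans (if-ind (i ==F j)) (cong ℚΣ.ind (bool-ext same-index same-element))
    where
    if-ind : ∀ b → (if b then ℚ.1ℚ else ℚ.0ℚ) ≡ ℚΣ.ind b
    if-ind true = refl
    if-ind false = refl
    same-index : (i ==F j) ≡ true → E (lk i) (lk j) ≡ true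
    same-index e rewrite ==F-sound e = E-refl (lk j)
    same-element : E (lk i) (lk j) ≡ true → (i ==F j) ≡ true
    same-element e = ==F-complete (lk-injective (E-sound _ _ e))

  I-delta : ∀ i (g : A → ℚ) → sumFin p (λ j → I i j ℚ.* g (lk j)) ≡ g (lk i)
  I-delta i g = begin
    sumFin p (λ j → I i j ℚ.* g (lk j))
      ≡⟨ sumFin-cong p (λ j → cong (ℚ._* g (lk j)) (I-lookup i j)) ⟩
    sumFin p (λ j → ℚΣ.ind (E (lk i) (lk j)) ℚ.* g (lk j))
      ≡⟨ sumFin-lookup (λ w → ℚΣ.ind (E (lk i) w) ℚ.* g w) ⟩
    ℚΣ.∑[ w ∈ K ] (ℚΣ.ind (E (lk i) w) ℚ.* g w)
      ≡⟨ ℚΣ.∑-cong K (λ w _ → cong (λ b → ℚΣ.ind b ℚ.* g w) (boolEq-sym E E-sound E-refl (lk i) w)) ⟩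
    ℚΣ.∑[ w ∈ K ] (ℚΣ.ind (E w (lk i)) ℚ.* g w)
      ≡⟨ ℚΣ.∑-delta E E-sound E-refl K K-nodup (∈-lookup i) g ⟩
    g (lk i) ∎
    where
    open ≡-Reasoning

  left-invertible-kernel : ∀ {X Y : Matrix p} → (∀ i j → (Y · X) i j ≡ I i j) → (g : A → ℚ) →
    (∀ k → sumFin p (λ j → X k j ℚ.* g (lk j)) ≡ ℚ.0ℚ) → ∀ {w} → w ∈ K → g w ≡ ℚ.0ℚ
  left-invertible-kernel {X} {Y} YX≡I g Xg≡0 w∈ = subst (λ w → g w ≡ ℚ.0ℚ) (sym (lookup-index w∈)) (begin
    g (lk i)                                                ≡⟨ sym (I-delta i g) ⟩
    sumFin p (λ j → I i j ℚ.* g (lk j))                      ≡⟨ sumFin-cong p (λ j → cong (ℚ._* g (lk j)) (sym (YX≡I i j))) ⟩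
    sumFin p (λ j → (Y · X) i j ℚ.* g (lk j))                ≡⟨ ·-apply Y X (g ∘ lk) i ⟩
    sumFin p (λ k → Y i k ℚ.* sumFin p (λ j → X k j ℚ.* g (lk j)))
      ≡⟨ sumFin-zero p (λ k → trans (cong (Y i k ℚ.*_) (Xg≡0 k)) (ℚP.*-zeroʳ (Y i k))) ⟩
    ℚ.0ℚ ∎)
    where
    open ≡-Reasoning
    i = Any.index w∈

-- If λ(t) = 0 the column
-- μ(t,·) is a nonzero kernel vector; otherwise M = Z diag(λ) Zᵀ has the
-- inverse (Zᵀ)⁻¹ diag(λ)⁻¹ Z⁻¹ with Z⁻¹ given by μ.

module JoinMatrix {A : Set} (P : FinitePoset A) (J : JoinClosedUpSet P) (f : A → ℤ) where

  open FinitePoset P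
  open JoinClosedUpSet J
  open JoinFactorisation P J f public
  open ListIndexed E E-sound E-refl U U-nodup public
  open ℚΣ using (∑; ind)
  open ≡-Reasoning

  joinMatrix : Matrix p
  joinMatrix i j = ι (f (lk i ⊔ lk j))

  Nonvanishing : Set
  Nonvanishing = ∀ {t} → t ∈ U → lam t ≢ ℤ.+ 0

  ζ-μ-Uℚ : ∀ {ρ σ} → ρ ∈ U → σ ∈ U → ∑[ τ ∈ U ] (ind (R ρ τ) ℚ.* ι (μ τ σ)) ≡ ind (E ρ σ)
  ζ-μ-Uℚ {ρ} {σ} ρ∈ σ∈ = begin
    ∑[ τ ∈ U ] (ind (R ρ τ) ℚ.* ι (μ τ σ))
      ≡⟨ ℚΣ.∑-cong U (λ τ _ → trans (cong (ℚ._* ι (μ τ σ)) (sym (ι-ind (R ρ τ)))) (sym (ι-* (ℤΣ.ind (R ρ τ)) (μ τ σ)))) ⟩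
    ∑[ τ ∈ U ] ι (ℤΣ.ind (R ρ τ) ℤ.* μ τ σ)   ≡⟨ sym (ι-∑ U _) ⟩
    ι (ℤΣ.∑[ τ ∈ U ] (ℤΣ.ind (R ρ τ) ℤ.* μ τ σ)) ≡⟨ cong ι (ζ-μ-U ρ∈ σ∈) ⟩
    ι (ℤΣ.ind (E ρ σ))                        ≡⟨ ι-ind (E ρ σ) ⟩
    ind (E ρ σ) ∎

  join-kernelℚ : ∀ {t ρ} → t ∈ U → ρ ∈ U → ∑[ σ ∈ U ] (ι (f (ρ ⊔ σ)) ℚ.* ι (μ t σ)) ≡ ind (R ρ t) ℚ.* ι (lam t)
  join-kernelℚ {t} {ρ} t∈ ρ∈ = begin
    ∑[ σ ∈ U ] (ι (f (ρ ⊔ σ)) ℚ.* ι (μ t σ)) ≡⟨ ℚΣ.∑-cong U (λ σ _ → sym (ι-* (f (ρ ⊔ σ)) (μ t σ))) ⟩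
    ∑[ σ ∈ U ] ι (f (ρ ⊔ σ) ℤ.* μ t σ)       ≡⟨ sym (ι-∑ U _) ⟩
    ι (ℤΣ.∑[ σ ∈ U ] (f (ρ ⊔ σ) ℤ.* μ t σ))  ≡⟨ cong ι (join-kernel t∈ ρ∈) ⟩
    ι (ℤΣ.ind (R ρ t) ℤ.* lam t)              ≡⟨ ι-* (ℤΣ.ind (R ρ t)) (lam t) ⟩
    ι (ℤΣ.ind (R ρ t)) ℚ.* ι (lam t)          ≡⟨ cong (ℚ._* ι (lam t)) (ι-ind (R ρ t)) ⟩
    ind (R ρ t) ℚ.* ι (lam t) ∎

  -- a vanishing λ(t) makes μ(t,·) a kernel vector with entry 1 at t
  invertible⇒nonvanishing : Invertible joinMatrix → Nonvanishing
  invertible⇒nonvanishing (Y , _ , YM≡I) {t} t∈ lam≡0 =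
    ℚP.1≢0 (trans (cong ι (sym (μ-diag (U⊆L t∈)))) (left-invertible-kernel {joinMatrix} {Y} YM≡I (λ σ → ι (μ t σ)) kernel t∈))
    where
    kernel : ∀ k → sumFin p (λ j → joinMatrix k j ℚ.* ι (μ t (lk j))) ≡ ℚ.0ℚ
    kernel k = begin
      sumFin p (λ j → ι (f (lk k ⊔ lk j)) ℚ.* ι (μ t (lk j))) ≡⟨ sumFin-lookup _ ⟩
      ∑[ σ ∈ U ] (ι (f (lk k ⊔ σ)) ℚ.* ι (μ t σ))           ≡⟨ join-kernelℚ t∈ (∈-lookup k) ⟩
      ind (R (lk k) t) ℚ.* ι (lam t)                          ≡⟨ cong (λ a → ind (R (lk k) t) ℚ.* ι a) lam≡0 ⟩
      ind (R (lk k) t) ℚ.* ℚ.0ℚ                               ≡⟨ ℚP.*-zeroʳ (ind (R (lk k) t)) ⟩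
      ℚ.0ℚ ∎

  module _ (nonvanishing : Nonvanishing) where

    c : A → ℚ
    c s = recip (ι (lam s))

    c-inverse : ∀ {s} → s ∈ U → c s ℚ.* ι (lam s) ≡ ℚ.1ℚ
    c-inverse {s} s∈ = recip-inverse (ι (lam s)) (λ e → nonvanishing s∈ (ι-zero (lam s) e))

    inv : A → A → ℚ
    inv ρ ρ' = ∑[ s ∈ U ] (ι (μ s ρ) ℚ.* (c s ℚ.* ι (μ s ρ')))

    inv-sym : ∀ ρ ρ' → inv ρ ρ' ≡ inv ρ' ρ
    inv-sym ρ ρ' = ℚΣ.∑-cong U (λ s _ → swap (ι (μ s ρ)) (c s) (ι (μ s ρ')))
      where
      swap : ∀ a b d → a ℚ.* (b ℚ.* d) ≡ d ℚ.* (b ℚ.* a)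
      swap a b d = trans (ℚP.*-comm a (b ℚ.* d)) (trans (ℚP.*-assoc b d a)
                     (trans (ℚP.*-comm b (d ℚ.* a)) (trans (ℚP.*-assoc d a b) (cong (d ℚ.*_) (ℚP.*-comm a b)))))

    join-inv : ∀ {ρ ρ'} → ρ ∈ U → ρ' ∈ U → ∑[ κ ∈ U ] (ι (f (ρ ⊔ κ)) ℚ.* inv κ ρ') ≡ ind (E ρ ρ')
    join-inv {ρ} {ρ'} ρ∈ ρ'∈ = begin
      ∑[ κ ∈ U ] (ι (f (ρ ⊔ κ)) ℚ.* inv κ ρ')
        ≡⟨ ℚΣ.∑-cong U (λ κ _ → ℚΣ.∑-*ˡ U (ι (f (ρ ⊔ κ))) _) ⟩
      ∑[ κ ∈ U ] ∑[ s ∈ U ] (ι (f (ρ ⊔ κ)) ℚ.* (ι (μ s κ) ℚ.* (c s ℚ.* ι (μ s ρ'))))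
        ≡⟨ ℚΣ.∑-comm U U _ ⟩
      ∑[ s ∈ U ] ∑[ κ ∈ U ] (ι (f (ρ ⊔ κ)) ℚ.* (ι (μ s κ) ℚ.* (c s ℚ.* ι (μ s ρ'))))
        ≡⟨ ℚΣ.∑-cong U (λ s _ → trans (ℚΣ.∑-cong U (λ κ _ → sym (ℚP.*-assoc (ι (f (ρ ⊔ κ))) _ _)))
                                        (sym (ℚΣ.∑-*ʳ U (c s ℚ.* ι (μ s ρ')) _))) ⟩
      ∑[ s ∈ U ] (∑[ κ ∈ U ] (ι (f (ρ ⊔ κ)) ℚ.* ι (μ s κ)) ℚ.* (c s ℚ.* ι (μ s ρ')))
        ≡⟨ ℚΣ.∑-cong U (λ s s∈ → trans (cong (ℚ._* (c s ℚ.* ι (μ s ρ'))) (join-kernelℚ s∈ ρ∈)) (cancel s∈)) ⟩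
      ∑[ s ∈ U ] (ind (R ρ s) ℚ.* ι (μ s ρ'))
        ≡⟨ ζ-μ-Uℚ ρ∈ ρ'∈ ⟩
      ind (E ρ ρ') ∎
      where
      cancel : ∀ {s} → s ∈ U → (ind (R ρ s) ℚ.* ι (lam s)) ℚ.* (c s ℚ.* ι (μ s ρ')) ≡ ind (R ρ s) ℚ.* ι (μ s ρ')
      cancel {s} s∈ = begin
        (ind (R ρ s) ℚ.* ι (lam s)) ℚ.* (c s ℚ.* ι (μ s ρ'))  ≡⟨ ℚP.*-assoc (ind (R ρ s)) _ _ ⟩
        ind (R ρ s) ℚ.* (ι (lam s) ℚ.* (c s ℚ.* ι (μ s ρ')))  ≡⟨ cong (ind (R ρ s) ℚ.*_) (sym (ℚP.*-assoc (ι (lam s)) (c s) (ι (μ s ρ')))) ⟩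
        ind (R ρ s) ℚ.* ((ι (lam s) ℚ.* c s) ℚ.* ι (μ s ρ'))  ≡⟨ cong (λ q → ind (R ρ s) ℚ.* (q ℚ.* ι (μ s ρ')))
                                                                   (trans (ℚP.*-comm (ι (lam s)) (c s)) (c-inverse s∈)) ⟩
        ind (R ρ s) ℚ.* (ℚ.1ℚ ℚ.* ι (μ s ρ'))                 ≡⟨ cong (ind (R ρ s) ℚ.*_) (ℚP.*-identityˡ _) ⟩
        ind (R ρ s) ℚ.* ι (μ s ρ') ∎

    invMatrix : Matrix p
    invMatrix i j = inv (lk i) (lk j)

    joinMatrix-sym : ∀ i j → joinMatrix i j ≡ joinMatrix j i
    joinMatrix-sym i j = cong (ι ∘ f) (⊔-comm (∈-lookup i) (∈-lookup j))

    right-inverse : ∀ i j → (joinMatrix · invMatrix) i j ≡ I i j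
    right-inverse i j = begin
      sumFin p (λ k → ι (f (lk i ⊔ lk k)) ℚ.* inv (lk k) (lk j)) ≡⟨ sumFin-lookup _ ⟩
      ∑[ κ ∈ U ] (ι (f (lk i ⊔ κ)) ℚ.* inv κ (lk j))            ≡⟨ join-inv (∈-lookup i) (∈-lookup j) ⟩
      ind (E (lk i) (lk j))                                      ≡⟨ sym (I-lookup i j) ⟩
      I i j ∎

    nonvanishing⇒invertible : Invertible joinMatrix
    nonvanishing⇒invertible = invMatrix , right-inverse ,
      symmetric-inverse joinMatrix invMatrix joinMatrix-sym (λ i j → inv-sym (lk i) (lk j)) right-inverse

  invertible⇔nonvanishing : Invertible joinMatrix ⇔ Nonvanishing
  invertible⇔nonvanishing = mk⇔ invertible⇒nonvanishing nonvanishing⇒invertible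

private
  ++-nodup : {A : Set} (xs ys : List A) → Nodup xs → Nodup ys → (∀ {z} → z ∈ xs → z ∉ ys) → Nodup (xs ++ ys)
  ++-nodup [] ys _ ys-nd _ = ys-nd
  ++-nodup (x ∷ xs) ys (x∉ ∷ xs-nd) ys-nd disjoint =
    (λ x∈ → [ x∉ , disjoint (here refl) ]′ (∈-++⁻ xs x∈)) ∷ ++-nodup xs ys xs-nd ys-nd (disjoint ∘ there)

  concatMap-∈⁺ : {A B : Set} (g : A → List B) {xs : List A} {x : A} {y : B} → x ∈ xs → y ∈ g x → y ∈ concatMap g xs
  concatMap-∈⁺ g {z ∷ xs} (here refl) y∈ = ∈-++⁺ˡ y∈
  concatMap-∈⁺ g {z ∷ xs} (there x∈) y∈ = ∈-++⁺ʳ (g z) (concatMap-∈⁺ g x∈ y∈)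

  concatMap-∈⁻ : {A B : Set} (g : A → List B) (xs : List A) {y : B} → y ∈ concatMap g xs → Σ A λ x → x ∈ xs × y ∈ g x
  concatMap-∈⁻ g (z ∷ xs) y∈ with ∈-++⁻ (g z) y∈
  ... | inj₁ y∈gz = z , here refl , y∈gz
  ... | inj₂ y∈rest = let (x , x∈ , y∈gx) = concatMap-∈⁻ g xs y∈rest in x , there x∈ , y∈gx

  concatMap-nodup : {A B : Set} (g : A → List B) (xs : List A) → Nodup xs → (∀ x → Nodup (g x)) →
    (∀ {a b y} → y ∈ g a → y ∈ g b → a ≡ b) → Nodup (concatMap g xs)
  concatMap-nodup g [] _ _ _ = []
  concatMap-nodup g (x ∷ xs) (x∉ ∷ nd) g-nd disjoint = ++-nodup (g x) (concatMap g xs) (g-nd x)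
    (concatMap-nodup g xs nd g-nd disjoint)
    (λ y∈gx y∈rest → let (a , a∈ , y∈ga) = concatMap-∈⁻ g xs y∈rest in x∉ (subst (_∈ xs) (disjoint y∈ga y∈gx) a∈))

  map-nodup : {A B : Set} (g : A → B) (xs : List A) → (∀ {a b} → g a ≡ g b → a ≡ b) → Nodup xs → Nodup (map g xs)
  map-nodup g [] _ [] = []
  map-nodup g (x ∷ xs) inj (x∉ ∷ nd) =
    (λ gx∈ → let (a , a∈ , gx≡ga) = ∈-map⁻ g gx∈ in x∉ (subst (_∈ xs) (sym (inj gx≡ga)) a∈)) ∷ map-nodup g xs inj nd

  allFin-nodup : ∀ n → Nodup (allFin n)
  allFin-nodup n = go (UniqueP.allFin⁺ n)
    where
    go : ∀ {xs : List (Fin n)} → Unique xs → Nodup xs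
    go AllPairs.[] = []
    go (x≢ AllPairs.∷ u) = (λ x∈ → All.lookup x≢ x∈ refl) ∷ go u

  allVecs-complete : {A : Set} (xs : List A) (n : ℕ) (v : Vec A n) → (∀ i → Vec.lookup v i ∈ xs) → v ∈ allVecs xs n
  allVecs-complete xs zero [] _ = here refl
  allVecs-complete xs (suc n) (a ∷ v) entries∈ = concatMap-∈⁺ (λ x → map (x ∷_) (allVecs xs n)) (entries∈ Fin.zero)
    (∈-map⁺ (a ∷_) (allVecs-complete xs n v (entries∈ ∘ Fin.suc)))

  allVecs-nodup : {A : Set} (xs : List A) (n : ℕ) → Nodup xs → Nodup (allVecs xs n)
  allVecs-nodup xs zero _ = (λ ()) ∷ []
  allVecs-nodup xs (suc n) nd = concatMap-nodup _ xs nd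
    (λ x → map-nodup (x ∷_) (allVecs xs n) VecP.∷-injectiveʳ (allVecs-nodup xs n nd))
    (λ {a} {b} y∈ y∈' → let (_ , _ , y≡) = ∈-map⁻ (a ∷_) y∈ ; (_ , _ , y≡') = ∈-map⁻ (b ∷_) y∈' in
                         VecP.∷-injectiveˡ (trans (sym y≡) y≡'))

  bools : List Bool
  bools = true ∷ false ∷ []

  bools-nodup : Nodup bools
  bools-nodup = (λ { (here ()) ; (there ()) }) ∷ ((λ ()) ∷ [])

  bool-∈ : ∀ b → b ∈ bools
  bool-∈ true = here refl
  bool-∈ false = there (here refl)

  candidates : ∀ n → List (LPart n)
  candidates n = concatMap (λ r → map (lpart r) (allVecs bools n)) (allVecs (allFin n) n)

Πl-nodup : ∀ n → Nodup (Πl n)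
Πl-nodup n = filter-nodup valid (candidates n) (concatMap-nodup _ _ (allVecs-nodup _ n (allFin-nodup n))
  (λ r → map-nodup (lpart r) _ (cong lab) (allVecs-nodup _ n bools-nodup))
  (λ {a} {b} y∈ y∈' → let (_ , _ , y≡) = ∈-map⁻ (lpart a) y∈ ; (_ , _ , y≡') = ∈-map⁻ (lpart b) y∈' in
                       cong rep (trans (sym y≡) y≡')))

Πl-valid : ∀ {n} {π : LPart n} → π ∈ Πl n → valid π ≡ true
Πl-valid {n} π∈ = proj₂ (filter-∈⁻ valid (candidates n) π∈)

Πl-complete : ∀ {n} {π : LPart n} → valid π ≡ true → π ∈ Πl n
Πl-complete {n} {lpart r l} v = filter-∈⁺ valid (candidates n)
  (concatMap-∈⁺ _ (allVecs-complete _ n r (λ _ → ∈-allFin _)) (∈-map⁺ (lpart r) (allVecs-complete _ n l (bool-∈ ∘ Vec.lookup l)))) v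

record Valid {n} (π : LPart n) (i : Fin n) : Set where
  field
    rep≤ : toℕ (rp π i) ≤ toℕ i
    rep-idem : rp π (rp π i) ≡ rp π i
    lab-rep : lb π i ≡ lb π (rp π i)

valid⇒ : ∀ {n} (π : LPart n) → valid π ≡ true → ∀ i → Valid π i
valid⇒ π v i = record
  { rep≤ = ℕP.≤ᵇ⇒≤ _ _ (T-true (∧-true₁ conds))
  ; rep-idem = ==F-sound (∧-true₁ (∧-true₂ {toℕ (rp π i) ℕ.≤ᵇ toℕ i} conds))
  ; lab-rep = ==B-sound (∧-true₂ {rp π (rp π i) ==F rp π i} (∧-true₂ {toℕ (rp π i) ℕ.≤ᵇ toℕ i} conds)) }
  where
  conds = forallFin-elim _ v i
  T-true : ∀ {b} → b ≡ true → T b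
  T-true refl = _

⇒valid : ∀ {n} (π : LPart n) → (∀ i → Valid π i) → valid π ≡ true
⇒valid π h = forallFin-intro _ λ i → let open Valid (h i) in
  ∧-intro (true-T (ℕP.≤⇒≤ᵇ rep≤)) (∧-intro (==F-complete rep-idem) (==B-complete lab-rep))
  where
  true-T : ∀ {b} → T b → b ≡ true
  true-T {true} _ = refl

lab-block : ∀ {n} (π : LPart n) → valid π ≡ true → ∀ {i j} → rp π j ≡ rp π i → lb π j ≡ lb π i
lab-block π v {i} {j} same = trans (Valid.lab-rep (valid⇒ π v j))
  (trans (cong (lb π) same) (sym (Valid.lab-rep (valid⇒ π v i))))

record Below {n} (σ π : LPart n) (i : Fin n) : Set where
  field
    same-block : rp π i ≡ rp π (rp σ i)
    lab-mono : lb σ i ≡ true → lb π i ≡ true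

leq⇒ : ∀ {n} (σ π : LPart n) → leq σ π ≡ true → ∀ i → Below σ π i
leq⇒ σ π σ≤π i = record
  { same-block = ==F-sound (∧-true₁ conds) ; lab-mono = ⇒-elim (∧-true₂ {rp π i ==F rp π (rp σ i)} conds) }
  where
  conds = forallFin-elim _ σ≤π i

⇒leq : ∀ {n} (σ π : LPart n) → (∀ i → Below σ π i) → leq σ π ≡ true
⇒leq σ π h = forallFin-intro _ λ i → let open Below (h i) in ∧-intro (==F-complete same-block) (⇒-intro lab-mono)

vec-ext : ∀ {A : Set} {n} {u v : Vec A n} → (∀ i → Vec.lookup u i ≡ Vec.lookup v i) → u ≡ v
vec-ext {u = u} {v} u≗v = trans (sym (VecP.tabulate∘lookup u)) (trans (VecP.tabulate-cong u≗v) (VecP.tabulate∘lookup v))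

lpart-ext : ∀ {n} {σ π : LPart n} → (∀ i → rp σ i ≡ rp π i) → (∀ i → lb σ i ≡ lb π i) → σ ≡ π
lpart-ext {σ = lpart r l} {lpart r' l'} same-rep same-lab = cong₂ lpart (vec-ext same-rep) (vec-ext same-lab)

eqLP-sound : ∀ {n} (σ π : LPart n) → eqLP σ π ≡ true → σ ≡ π
eqLP-sound σ π e = lpart-ext (λ i → ==F-sound (∧-true₁ (forallFin-elim _ e i)))
                             (λ i → ==B-sound (∧-true₂ {rp σ i ==F rp π i} (forallFin-elim _ e i)))

eqLP-refl : ∀ {n} (σ : LPart n) → eqLP σ σ ≡ true
eqLP-refl σ = forallFin-intro _ λ i → ∧-intro (==F-complete {x = rp σ i} refl) (==B-complete {lb σ i} refl)

leq-refl : ∀ {n} (π : LPart n) → valid π ≡ true → leq π π ≡ true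
leq-refl π v = ⇒leq π π λ i → record { same-block = sym (Valid.rep-idem (valid⇒ π v i)) ; lab-mono = λ l → l }

leq-trans : ∀ {n} (a b c : LPart n) → leq a b ≡ true → leq b c ≡ true → leq a c ≡ true
leq-trans a b c a≤b b≤c = ⇒leq a c λ i → record
  { same-block = trans (Below.same-block (leq⇒ b c b≤c i))
      (trans (cong (rp c) (Below.same-block (leq⇒ a b a≤b i))) (sym (Below.same-block (leq⇒ b c b≤c (rp a i)))))
  ; lab-mono = Below.lab-mono (leq⇒ b c b≤c i) ∘ Below.lab-mono (leq⇒ a b a≤b i) }

-- mutually below: each representative is at most the other one
leq-antisym : ∀ {n} (σ π : LPart n) → valid σ ≡ true → valid π ≡ true → leq σ π ≡ true → leq π σ ≡ true → σ ≡ π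
leq-antisym σ π vσ vπ σ≤π π≤σ = lpart-ext same-rep
  (λ i → bool-ext (Below.lab-mono (leq⇒ σ π σ≤π i)) (Below.lab-mono (leq⇒ π σ π≤σ i)))
  where
  same-rep : ∀ i → rp σ i ≡ rp π i
  same-rep i = FinP.toℕ-injective (ℕP.≤-antisym
    (subst (λ t → toℕ t ≤ toℕ (rp π i)) (sym (Below.same-block (leq⇒ π σ π≤σ i))) (Valid.rep≤ (valid⇒ σ vσ (rp π i))))
    (subst (λ t → toℕ t ≤ toℕ (rp σ i)) (sym (Below.same-block (leq⇒ σ π σ≤π i))) (Valid.rep≤ (valid⇒ π vπ (rp σ i)))))

hasLabelled-mono : ∀ {n} (σ π : LPart n) → leq σ π ≡ true → hasLabelled σ ≡ true → hasLabelled π ≡ true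
hasLabelled-mono {n} σ π σ≤π h = let (i , _ , li) = anyL-elim (lb σ) (allFin n) h in
  anyL-intro (lb π) (allFin n) i (∈-allFin i) (Below.lab-mono (leq⇒ σ π σ≤π i) li)

-- Meets are blockwise intersections (the new
-- representative of i is the least element sharing both blocks of i) and
-- the top is a single labelled block; the join of σ and π is then the
-- meet of all their common upper bounds, which is what makes the search
-- in the definition of _∨L_ succeed.

first : ∀ {n} → (Fin n → Bool) → Maybe (Fin n)
first {zero} p = nothing
first {suc n} p = if p Fin.zero then just Fin.zero else Maybe.map Fin.suc (first (p ∘ Fin.suc))

first-spec : ∀ {n} (p : Fin n → Bool) {i} → p i ≡ true → Σ (Fin n) λ r → first p ≡ just r × p r ≡ true × toℕ r ≤ toℕ i
first-spec {suc n} p {i} pi with p Fin.zero in p0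
... | true = Fin.zero , refl , p0 , z≤n
first-spec {suc n} p {Fin.zero} pi | false = ⊥-elim (true≢false (trans (sym pi) p0))
first-spec {suc n} p {Fin.suc i} pi | false =
  let (r , first≡r , pr , r≤i) = first-spec (p ∘ Fin.suc) pi in Fin.suc r , cong (Maybe.map Fin.suc) first≡r , pr , s≤s r≤i

first-cong : ∀ {n} (p q : Fin n → Bool) → (∀ j → p j ≡ q j) → first p ≡ first q
first-cong {zero} p q p≗q = refl
first-cong {suc n} p q p≗q rewrite p≗q Fin.zero with q Fin.zero
... | true = refl
... | false = cong (Maybe.map Fin.suc) (first-cong _ _ (p≗q ∘ Fin.suc))

module Meet {n} (σ π : LPart n) where

  sameBlocks : Fin n → Fin n → Bool
  sameBlocks i j = (rp σ j ==F rp σ i) ∧ (rp π j ==F rp π i)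

  sameBlocks-refl : ∀ i → sameBlocks i i ≡ true
  sameBlocks-refl i = ∧-intro (==F-complete {x = rp σ i} refl) (==F-complete {x = rp π i} refl)

  meetRep : Fin n → Fin n
  meetRep i = fromMaybe i (first (sameBlocks i))

  meetRep-spec : ∀ i → sameBlocks i (meetRep i) ≡ true × toℕ (meetRep i) ≤ toℕ i
  meetRep-spec i with first-spec (sameBlocks i) (sameBlocks-refl i)
  ... | r , first≡r , pr , r≤i rewrite first≡r = pr , r≤i

  meetRep-σ : ∀ i → rp σ (meetRep i) ≡ rp σ i
  meetRep-σ i = ==F-sound (∧-true₁ (proj₁ (meetRep-spec i)))

  meetRep-π : ∀ i → rp π (meetRep i) ≡ rp π i
  meetRep-π i = ==F-sound (∧-true₂ {rp σ (meetRep i) ==F rp σ i} (proj₁ (meetRep-spec i)))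

  meetRep-blocks : ∀ {i j} → rp σ j ≡ rp σ i → rp π j ≡ rp π i → meetRep j ≡ meetRep i
  meetRep-blocks {i} {j} σ-same π-same with first-spec (sameBlocks j) (sameBlocks-refl j)
  ... | r , first≡r , _ rewrite first≡r
      | sym (first-cong (sameBlocks j) (sameBlocks i)
               (λ k → cong₂ _∧_ (cong (rp σ k ==F_) σ-same) (cong (rp π k ==F_) π-same)))
      | first≡r = refl

  meet : LPart n
  meet = lpart (Vec.tabulate meetRep) (Vec.tabulate (λ i → lb σ i ∧ lb π i))

  rp-meet : ∀ i → rp meet i ≡ meetRep i
  rp-meet = VecP.lookup∘tabulate meetRep

  lb-meet : ∀ i → lb meet i ≡ lb σ i ∧ lb π i
  lb-meet = VecP.lookup∘tabulate (λ i → lb σ i ∧ lb π i)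

  meet-valid : valid σ ≡ true → valid π ≡ true → valid meet ≡ true
  meet-valid vσ vπ = ⇒valid meet λ i → record
    { rep≤ = subst (λ t → toℕ t ≤ toℕ i) (sym (rp-meet i)) (proj₂ (meetRep-spec i))
    ; rep-idem = begin
        rp meet (rp meet i)  ≡⟨ cong (rp meet) (rp-meet i) ⟩
        rp meet (meetRep i)  ≡⟨ rp-meet (meetRep i) ⟩
        meetRep (meetRep i)  ≡⟨ meetRep-blocks (meetRep-σ i) (meetRep-π i) ⟩
        meetRep i            ≡⟨ sym (rp-meet i) ⟩
        rp meet i            ∎
    ; lab-rep = begin
        lb meet i                                   ≡⟨ lb-meet i ⟩
        lb σ i ∧ lb π i                             ≡⟨ sym (cong₂ _∧_ (lab-block σ vσ (meetRep-σ i)) (lab-block π vπ (meetRep-π i))) ⟩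
        lb σ (meetRep i) ∧ lb π (meetRep i)         ≡⟨ sym (lb-meet (meetRep i)) ⟩
        lb meet (meetRep i)                         ≡⟨ cong (lb meet) (sym (rp-meet i)) ⟩
        lb meet (rp meet i)                         ∎ }
    where open ≡-Reasoning

  meet≤σ : leq meet σ ≡ true
  meet≤σ = ⇒leq meet σ λ i → record
    { same-block = trans (sym (meetRep-σ i)) (cong (rp σ) (sym (rp-meet i)))
    ; lab-mono = λ l → ∧-true₁ (trans (sym (lb-meet i)) l) }

  meet≤π : leq meet π ≡ true
  meet≤π = ⇒leq meet π λ i → record
    { same-block = trans (sym (meetRep-π i)) (cong (rp π) (sym (rp-meet i)))
    ; lab-mono = λ l → ∧-true₂ {lb σ i} (trans (sym (lb-meet i)) l) }

  meet-greatest : ∀ τ → leq τ σ ≡ true → leq τ π ≡ true → leq τ meet ≡ true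
  meet-greatest τ τ≤σ τ≤π = ⇒leq τ meet λ i → let hσ = leq⇒ τ σ τ≤σ i ; hπ = leq⇒ τ π τ≤π i in record
    { same-block = trans (rp-meet i) (trans (sym (meetRep-blocks (sym (Below.same-block hσ)) (sym (Below.same-block hπ))))
                                            (sym (rp-meet (rp τ i))))
    ; lab-mono = λ l → trans (lb-meet i) (∧-intro (Below.lab-mono hσ l) (Below.lab-mono hπ l)) }

toZero : ∀ {n} → Fin n → Fin n
toZero Fin.zero = Fin.zero
toZero (Fin.suc _) = Fin.zero

toZero-const : ∀ {n} (i j : Fin n) → toZero i ≡ toZero j
toZero-const Fin.zero Fin.zero = refl
toZero-const Fin.zero (Fin.suc j) = refl
toZero-const (Fin.suc i) Fin.zero = refl
toZero-const (Fin.suc i) (Fin.suc j) = refl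

toZero≤ : ∀ {n} (i : Fin n) → toℕ (toZero i) ≤ toℕ i
toZero≤ Fin.zero = z≤n
toZero≤ (Fin.suc i) = z≤n

top : ∀ n → LPart n
top n = lpart (Vec.tabulate toZero) (Vec.tabulate (λ _ → true))

rp-top : ∀ {n} i → rp (top n) i ≡ toZero i
rp-top = VecP.lookup∘tabulate toZero

lb-top : ∀ {n} i → lb (top n) i ≡ true
lb-top = VecP.lookup∘tabulate (λ _ → true)

top-valid : ∀ n → valid (top n) ≡ true
top-valid n = ⇒valid (top n) λ i → record
  { rep≤ = subst (λ t → toℕ t ≤ toℕ i) (sym (rp-top i)) (toZero≤ i)
  ; rep-idem = trans (rp-top _) (trans (toZero-const _ i) (sym (rp-top i)))
  ; lab-rep = trans (lb-top i) (sym (lb-top (rp (top n) i))) }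

≤top : ∀ {n} (τ : LPart n) → leq τ (top n) ≡ true
≤top τ = ⇒leq τ (top _) λ i → record
  { same-block = trans (rp-top i) (trans (toZero-const i _) (sym (rp-top _))) ; lab-mono = λ _ → lb-top i }

meetAll : ∀ {n} → List (LPart n) → LPart n
meetAll {n} = foldr Meet.meet (top n)

meetAll-valid : ∀ {n} (K : List (LPart n)) → (∀ {w} → w ∈ K → valid w ≡ true) → valid (meetAll K) ≡ true
meetAll-valid {n} [] _ = top-valid n
meetAll-valid (w ∷ K) K-valid = Meet.meet-valid w (meetAll K) (K-valid (here refl)) (meetAll-valid K (K-valid ∘ there))

meetAll-lower : ∀ {n} (K : List (LPart n)) {w} → w ∈ K → leq (meetAll K) w ≡ true
meetAll-lower (x ∷ K) (here refl) = Meet.meet≤σ x (meetAll K)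
meetAll-lower (x ∷ K) {w} (there w∈) =
  leq-trans (Meet.meet x (meetAll K)) (meetAll K) w (Meet.meet≤π x (meetAll K)) (meetAll-lower K w∈)

meetAll-greatest : ∀ {n} (K : List (LPart n)) τ → (∀ {w} → w ∈ K → leq τ w ≡ true) → leq τ (meetAll K) ≡ true
meetAll-greatest [] τ _ = ≤top τ
meetAll-greatest (x ∷ K) τ τ≤K = Meet.meet-greatest x (meetAll K) τ (τ≤K (here refl)) (meetAll-greatest K τ (τ≤K ∘ there))

firstWith-spec : {A : Set} (p : A → Bool) (L : List A) (d : A) → ∀ {x} → x ∈ L → p x ≡ true →
  firstWith p L d ∈ L × p (firstWith p L d) ≡ true
firstWith-spec p (y ∷ L) d x∈ px with p y in py
... | true = here refl , py
firstWith-spec p (y ∷ L) d (here refl) px | false = ⊥-elim (true≢false (trans (sym px) py))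
firstWith-spec p (y ∷ L) d (there x∈) px | false = let (w∈ , pw) = firstWith-spec p L d x∈ px in there w∈ , pw

module Join {n} (σ π : LPart n) where

  upper : LPart n → Bool
  upper z = leq σ z ∧ leq π z

  isLub : LPart n → Bool
  isLub z = upper z ∧ allL (λ w → not (upper w) ∨ leq z w) (Πl n)

  lub : LPart n
  lub = meetAll (filterᵇ upper (Πl n))

  lub-isLub : isLub lub ≡ true
  lub-isLub = ∧-intro
    (∧-intro (meetAll-greatest _ σ (λ w∈ → ∧-true₁ (proj₂ (filter-∈⁻ upper (Πl n) w∈))))
             (meetAll-greatest _ π (λ {w} w∈ → ∧-true₂ {leq σ w} (proj₂ (filter-∈⁻ upper (Πl n) w∈)))))
    (allL-intro _ (Πl n) λ w w∈ → ⇒-intro λ up → meetAll-lower _ (filter-∈⁺ upper (Πl n) w∈ up))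

  lub∈ : lub ∈ Πl n
  lub∈ = Πl-complete (meetAll-valid _ (λ w∈ → Πl-valid (proj₁ (filter-∈⁻ upper (Πl n) w∈))))

  ∨L-spec : (σ ∨L π) ∈ Πl n × isLub (σ ∨L π) ≡ true
  ∨L-spec = firstWith-spec isLub (Πl n) π lub∈ lub-isLub

  ∨L-char : ∀ {τ} → τ ∈ Πl n → leq (σ ∨L π) τ ≡ leq σ τ ∧ leq π τ
  ∨L-char {τ} τ∈ = bool-ext
    (λ j≤τ → ∧-intro (leq-trans σ (σ ∨L π) τ (∧-true₁ (∧-true₁ lub-ok)) j≤τ)
                     (leq-trans π (σ ∨L π) τ (∧-true₂ {leq σ (σ ∨L π)} (∧-true₁ lub-ok)) j≤τ))
    (⇒-elim (allL-elim _ (Πl n) (∧-true₂ {upper (σ ∨L π)} lub-ok) τ τ∈))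
    where
    lub-ok = proj₂ ∨L-spec

Πl-poset : ∀ n → FinitePoset (LPart n)
Πl-poset n = record
  { E = eqLP ; R = leq ; L = Πl n ; E-sound = eqLP-sound ; E-refl = eqLP-refl
  ; R-refl = λ {x} x∈ → leq-refl x (Πl-valid x∈)
  ; R-trans = λ {x} {y} {z} → leq-trans x y z
  ; R-antisym = λ {x} {y} x∈ y∈ → leq-antisym x y (Πl-valid x∈) (Πl-valid y∈)
  ; L-nodup = Πl-nodup n }

module Labelled {n} (πX : LPart n) where

  inΠlX : LPart n → Bool
  inΠlX π = leq πX π ∧ hasLabelled π

  inΠlX-up : ∀ {x y} → y ∈ Πl n → inΠlX x ≡ true → leq x y ≡ true → inΠlX y ≡ true
  inΠlX-up {x} {y} _ x∈ x≤y = ∧-intro (leq-trans πX x y (∧-true₁ x∈) x≤y) (hasLabelled-mono x y x≤y (∧-true₂ {leq πX x} x∈))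

  ∨L-closed : ∀ {x y} → x ∈ ΠlX πX → y ∈ ΠlX πX → (x ∨L y) ∈ ΠlX πX
  ∨L-closed {x} {y} x∈ _ = filter-∈⁺ inΠlX (Πl n) j∈ (inΠlX-up {x} {x ∨L y} j∈ (proj₂ (filter-∈⁻ inΠlX (Πl n) x∈)) x≤j)
    where
    j∈ = proj₁ (Join.∨L-spec x y)
    x≤j : leq x (x ∨L y) ≡ true
    x≤j = ∧-true₁ {leq x (x ∨L y)} (trans (sym (Join.∨L-char x y j∈)) (leq-refl (x ∨L y) (Πl-valid j∈)))

  ΠlX-upset : JoinClosedUpSet (Πl-poset n)
  ΠlX-upset = record
    { inU = inΠlX ; inU-up = λ {x} {y} → inΠlX-up {x} {y} ; _⊔_ = _∨L_
    ; ⊔-closed = λ {x} {y} → ∨L-closed {x} {y} ; ⊔-char = λ {x} {y} _ _ → Join.∨L-char x y }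

  open JoinMatrix (Πl-poset n) ΠlX-upset (λ σ → ℤ.+ (m σ)) public

  μF≡μ-fuel : ∀ f x y → μF f x y ≡ μ-fuel f x y
  μF≡μ-fuel zero x y = refl
  μF≡μ-fuel (suc f) x y with eqLP x y
  ... | true = refl
  ... | false with leq x y
  ... | true = cong ℤ.-_ (ℤΣ.∑-cong (filterᵇ (between x y) (Πl n)) λ z _ → μF≡μ-fuel f x z)
  ... | false = refl

  λF≡lam : ∀ {τ} → τ ∈ Πl n → λF πX τ ≡ lam τ
  λF≡lam {τ} τ∈ = trans (ℤΣ.∑-cong (filterᵇ (leq τ) U) (λ σ _ → cong (ℤ._* ℤ.+ (m σ)) (μF≡μ-fuel (length (Πl n)) τ σ)))
    (ℤΣ.∑-restrict (leq τ) U (λ σ → μ τ σ ℤ.* ℤ.+ (m σ)) λ σ _ τ≰σ →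
      cong (ℤ._* ℤ.+ (m σ)) (μ-off-order (length (Πl n)) τ∈ τ≰σ))

  nonzero : LPart n → Bool
  nonzero π = not ⌊ λF πX π ℤ.≟ ℤ.+ 0 ⌋

  nonzero⇔ : ∀ {π} → π ∈ U → nonzero π ≡ true ⇔ lam π ≢ ℤ.+ 0
  nonzero⇔ {π} π∈ with λF πX π ℤ.≟ ℤ.+ 0 | λF≡lam (U⊆L π∈)
  ... | yes λ≡0 | λ≡lam = mk⇔ (λ ()) (λ lam≢0 → ⊥-elim (lam≢0 (trans (sym λ≡lam) λ≡0)))
  ... | no λ≢0 | λ≡lam = mk⇔ (λ _ lam≡0 → λ≢0 (trans λ≡lam lam≡0)) (λ _ → refl)

  ΠlX0≡ΠlX⇔nonvanishing : ΠlX0 πX ≡ ΠlX πX ⇔ Nonvanishing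
  ΠlX0≡ΠlX⇔nonvanishing = mk⇔
    (λ full {t} t∈ → Equivalence.to (nonzero⇔ t∈) (proj₂ (filter-∈⁻ nonzero U (subst (t ∈_) (sym full) t∈))))
    (λ nonvanishing → ListP.filter-all (T? ∘ nonzero)
      (All.tabulate λ t∈ → subst T (sym (Equivalence.from (nonzero⇔ t∈) (nonvanishing t∈))) _))

  -- a sublist obtained by filtering has full length only if nothing was dropped
  P≡P0⇔ΠlX0≡ΠlX : P πX ≡ P0 πX ⇔ ΠlX0 πX ≡ ΠlX πX
  P≡P0⇔ΠlX0≡ΠlX = mk⇔ (ListP.filter-complete (T? ∘ nonzero) ∘ sym) (sym ∘ cong length)

mMatrix-cast : ∀ {n} {K K' : List (LPart n)} → K ≡ K' → (e : length K ≡ length K') →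
  ∀ i j → mMatrix K i j ≡ mMatrix K' (cast e i) (cast e j)
mMatrix-cast {K = K} refl e i j = sym (cong₂ (mMatrix K) (FinP.cast-is-id e i) (FinP.cast-is-id e j))

M-invertible⇔ : ∀ {n} (πX : LPart n) →
  (Invertible (M πX) ⇔ (P πX ≡ P0 πX))
  × (P πX ≡ P0 πX → Σ (P0 πX ≡ P πX) λ e → ∀ i j → M0 πX i j ≡ M πX (cast e i) (cast e j))
M-invertible⇔ πX = invertible⇔P≡P0 , M0≡M
  where
  open Labelled πX
  invertible⇔P≡P0 : Invertible (M πX) ⇔ (P πX ≡ P0 πX)
  invertible⇔P≡P0 = ⇔-sym P≡P0⇔ΠlX0≡ΠlX ⇔-∘ (⇔-sym ΠlX0≡ΠlX⇔nonvanishing ⇔-∘ invertible⇔nonvanishing)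
  M0≡M : P πX ≡ P0 πX → Σ (P0 πX ≡ P πX) λ e → ∀ i j → M0 πX i j ≡ M πX (cast e i) (cast e j)
  M0≡M P≡P0 = sym P≡P0 , mMatrix-cast (Equivalence.to P≡P0⇔ΠlX0≡ΠlX P≡P0) (sym P≡P0)

corollary6p9 : (n k : ℕ) (ℓ : Vec Bool n) → numTrue ℓ ≡ k →
    (Invertible (M (singletonLP ℓ)) ⇔ (P (singletonLP ℓ) ≡ P0 (singletonLP ℓ)))
    × (P (singletonLP ℓ) ≡ P0 (singletonLP ℓ) →
       Σ (P0 (singletonLP ℓ) ≡ P (singletonLP ℓ)) λ e →
         ∀ i j → M0 (singletonLP ℓ) i j ≡ M (singletonLP ℓ) (cast e i) (cast e j))
corollary6p9 n k ℓ _ = M-invertible⇔ (singletonLP ℓ)
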